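{- Let $m\ge 2$, let $n_1,\dots,n_m$ be odd integers with $n_i\ge 5$, and let $\mathcal{C}=\mathcal{C}(C_{n_1},\dots,C_{n_m})$ be the chain cycle obtained by identifying $v^i_{\frac{n_i+1}{2}+1}$ with $v^{i+1}_1$ for each $i=1,\dots,m-1$. Then the vertex cover number of the strong resolving graph of $\mathcal{C}$ is $\alpha(\mathcal{C}_{SR})=m-1+\lfloor\frac{n_1}{2}\rfloor+\lfloor\frac{n_m}{2}\rfloor+\sum_{i=2}^{m-1}\lfloor\frac{n_i-2}{2}\rfloor$.
   Context: The cycles $C_{n_1},\dots,C_{n_m}$ are pairwise disjoint, $V(C_{n_i})=\{v^i_1,\dots,v^i_{n_i}\}$ with $v^i_j$ adjacent to $v^i_{j+1}$ ($1\le j<n_i$) and $v^i_{n_i}$ adjacent to $v^i_1$; the chain cycle is obtained from their disjoint union by the stated identifications. In a connected graph $G$ with distance $d$, $u$ is maximally distant from $v$ if $d(v,w)\le d(u,v)$ for every neighbor $w$ of $u$; $u,v$ are mutually maximally distant if each is maximally distant from the other. The strong resolving graph $G_{SR}$ has vertex set $V(G)$, with $u,v$ adjacent iff $u$ and $v$ are mutually maximally distant in $G$. The vertex cover number $\alpha(H)$ is the minimum size of a set of vertices meeting every edge of $H$. -}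

module Defs where

open import Data.Nat using (ℕ; zero; suc; _+_; _*_; _∸_; _≤_; _<_; _/_; _≡ᵇ_)
open import Data.Nat.ListAction using (sum)
open import Data.Bool using (if_then_else_; _∨_)
open import Data.Fin using (Fin; toℕ)
open import Data.List using (List; length; tabulate)
open import Data.List.Membership.Propositional using (_∈_)
open import Data.Product using (Σ; _×_; ∃)
open import Data.Sum using (_⊎_)
open import Relation.Binary.PropositionalEquality using (_≡_; _≢_)
open import Relation.Nullary using (¬_)

Odd : ℕ → Set
Odd k = ∃ λ t → k ≡ 2 * t + 1

-- The chain cycle C(C_{n_1},...,C_{n_m}), cycles indexed 0..m-1 and
-- vertices of cycle i indexed 0..n_i - 1 (0-based: paper's v^{i+1}_{j+1} is (i , j)).
module Chain (m : ℕ) (n : Fin m → ℕ) where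

  D : Set
  D = Σ (Fin m) (λ i → Fin (n i))

  cyc : D → ℕ
  cyc x = toℕ (Σ.proj₁ x)

  pos : D → ℕ
  pos x = toℕ (Σ.proj₂ x)

  CycAdj : D → D → Set
  CycAdj x y = Σ.proj₁ x ≡ Σ.proj₁ y ×
    ( (pos y ≡ suc (pos x))
    ⊎ (pos x ≡ suc (pos y))
    ⊎ (pos x ≡ 0 × suc (pos y) ≡ n (Σ.proj₁ y))
    ⊎ (pos y ≡ 0 × suc (pos x) ≡ n (Σ.proj₁ x)) )

  -- vertices removed by the identification: v^{i+1}_1 for i = 1..m-1,
  -- i.e. (i , 0) with i ≥ 1 (0-based); it is identified with the
  -- vertex v^i_{(n_i+1)/2+1}, i.e. (i-1 , (n_{i-1}+1)/2) (0-based).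
  Glued : D → Set
  Glued x = (0 < cyc x) × (pos x ≡ 0)

  -- the chain-cycle vertices: one representative per identification class
  IsV : D → Set
  IsV x = ¬ Glued x

  -- Rep x y : y is the representative of the class of x
  data Rep : D → D → Set where
    self : ∀ {x} → IsV x → Rep x x
    glue : ∀ {x y} → cyc x ≡ suc (cyc y) → pos x ≡ 0 →
           pos y ≡ (n (Σ.proj₁ y) + 1) / 2 → Rep x y

  -- adjacency in the chain cycle (quotient of the disjoint union)
  Adj : D → D → Set
  Adj u v = Σ D λ a → Σ D λ b → CycAdj a b × Rep a u × Rep b v

  data Walk : D → D → ℕ → Set where
    here : ∀ {x} → Walk x x 0
    step : ∀ {x y z k} → Adj x y → Walk y z k → Walk x z (suc k)

  Dist : D → D → ℕ → Set
  Dist u v k = Walk u v k × (∀ k' → Walk u v k' → k ≤ k')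

  MaxDist : D → D → Set
  MaxDist u v = ∀ w → Adj u w → ∀ a b → Dist v w a → Dist u v b → a ≤ b

  MMD : D → D → Set
  MMD u v = MaxDist u v × MaxDist v u

  SREdge : D → D → Set
  SREdge u v = IsV u × IsV v × u ≢ v × MMD u v

  VertexCover : List D → Set
  VertexCover C = ∀ u v → SREdge u v → u ∈ C ⊎ v ∈ C

  VertexCoverNumber : ℕ → Set
  VertexCoverNumber k =
    (Σ (List D) λ C → VertexCover C × length C ≡ k) ×
    (∀ C → VertexCover C → k ≤ length C)

  formula : ℕ
  formula = (m ∸ 1) + sum (tabulate term)
    where
    term : Fin m → ℕ
    term i = if (toℕ i ≡ᵇ 0) ∨ (suc (toℕ i) ≡ᵇ m)
             then n i / 2 else (n i ∸ 2) / 2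

-- Write n i = 2 t i + 1. Cycle i is entered at position 0 and left towards
-- cycle i + 1 at its cut vertex t i + 1, the antipode of 0 and 1. Hence the distance
-- from x in cycle i to y is the distance in cycle i from x to the exit towards y,
-- plus t k for every cycle k strictly in between, plus the distance from the
-- entry of y's cycle to y. By this formula x is maximally distant from y exactly
-- when x is antipodal (at distance t i) to that exit and is not a cut vertex, so
-- the edges of the strong resolving graph are the antipodal pairs inside a cycle
-- together with the pairs {0 or 1 of cycle i , t j or t j + 1 of cycle j} for i < j
-- (0 only in the first cycle, t j + 1 only in the last).
--
-- In each cycle the antipodal pairs avoiding the cut vertices form a path, which
-- needs t i cover vertices in the first and the last cycle and t i − 1 in a middle
-- one; attaining this leaves 0 or 1 uncovered unless the cycle is the last, and
-- t i or t i + 1 unless it is the first. So two cycles i < j cannot both be tight,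
-- every cycle but one exceeds its bound, and summing gives the formula. Positions
-- 1 … t i of every cycle together with position t i + 1 of the last one attain it.

module Submission where

open import Defs
open import Data.Nat
open import Data.Nat.Properties
open import Data.Nat.DivMod using (_/_; m*n/n≡m; m/n≡1+[m∸n]/n)
open import Data.Nat.Tactic.RingSolver using (solve-∀)
import Data.Nat.ListAction as ListAction
open import Data.Bool using (Bool; true; false; T; _∨_; _∧_; if_then_else_)
open import Data.Bool.Properties using (T?; T-∨; T-∧)
open import Data.Unit using (tt)
open import Data.Empty using (⊥; ⊥-elim)
open import Data.Fin using (Fin; toℕ; fromℕ<; zero; suc)
open import Data.Fin.Properties using (toℕ<n; toℕ-injective; toℕ-fromℕ<; fromℕ<-toℕ)
open import Data.List using (List; []; _∷_; length; [_]; concat; tabulate)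
open import Data.List.Properties using (length-++)
open import Data.List.Membership.Propositional using (_∈_)
open import Data.List.Membership.Propositional.Properties using (∈-concat⁺′; ∈-tabulate⁺)
open import Data.List.Relation.Unary.Any using (here; there)
open import Data.Product using (Σ; _×_; _,_; proj₁; proj₂)
import Data.Product as Product
open import Data.Sum using (_⊎_; inj₁; inj₂; [_,_]′)
import Data.Sum as Sum
open import Function using (id; _∘_)
open import Function.Bundles using (Equivalence)
open import Relation.Nullary using (¬_; yes; no; Dec; contradiction)
open import Relation.Nullary.Decidable using (_×-dec_)
open import Relation.Binary.Definitions using (tri<; tri≈; tri>)
open import Relation.Binary.PropositionalEquality hiding ([_])
open import Algebra.Properties.CommutativeMonoid.Sum +-0-commutativeMonoid
  using (sum-syntax; ∑-distrib-+; sum-cong-≗; sum-replicate-zero)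
open import Algebra.Properties.CommutativeSemigroup +-commutativeSemigroup using (x∙yz≈z∙xy)

-- Distances on a cycle of odd length

m∸n≡1+[m∸1+n] : ∀ {a b} → suc b ≤ a → a ∸ b ≡ suc (a ∸ suc b)
m∸n≡1+[m∸1+n] {suc a} {b} (s≤s le) = +-∸-assoc 1 le

m∸n≤1+[m∸1+n] : ∀ a b → a ∸ b ≤ suc (a ∸ suc b)
m∸n≤1+[m∸1+n] a b with suc b ≤? a
... | yes le = ≤-reflexive (m∸n≡1+[m∸1+n] le)
... | no nle = ≤-trans (≤-reflexive (m≤n⇒m∸n≡0 (≤-pred (≰⇒> nle)))) z≤n

abstract
  offset : ℕ → ℕ → ℕ → ℕ
  offset n p q with q ≤? p
  ... | yes _ = p ∸ q
  ... | no _ = n ∸ (q ∸ p)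

  offset-≥ : ∀ {n p q} → q ≤ p → offset n p q ≡ p ∸ q
  offset-≥ {n} {p} {q} le with q ≤? p
  ... | yes _ = refl
  ... | no nle = ⊥-elim (nle le)

  offset-< : ∀ {n p q} → p < q → offset n p q ≡ n ∸ (q ∸ p)
  offset-< {n} {p} {q} lt with q ≤? p
  ... | yes le = ⊥-elim (<⇒≱ lt le)
  ... | no _ = refl

offset<n : ∀ {n p q} → p < n → q < n → offset n p q < n
offset<n {n} {p} {q} pn qn with q ≤? p
... | yes le rewrite offset-≥ {n} le = ≤-<-trans (m∸n≤m p q) pn
... | no nle rewrite offset-< {n} (≰⇒> nle) = ∸-monoʳ-< {m = n} {n = q ∸ p} {o = 0} (m<n⇒0<n∸m (≰⇒> nle))
                 (≤-trans (m∸n≤m q p) (<⇒≤ qn))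

offset-self : ∀ {n p} → offset n p p ≡ 0
offset-self {n} {p} = trans (offset-≥ {n} {p} {p} ≤-refl) (n∸n≡0 p)

offset≡0⇒≡ : ∀ {n p q} → q < n → offset n p q ≡ 0 → p ≡ q
offset≡0⇒≡ {n} {p} {q} qn e with q ≤? p
... | yes le rewrite offset-≥ {n} le = ≤-antisym (m∸n≡0⇒m≤n e) le
... | no nle rewrite offset-< {n} (≰⇒> nle) = ⊥-elim (<⇒≱ qn (≤-trans (m∸n≡0⇒m≤n e) (m∸n≤m q p)))

offset-comm : ∀ {n p q} → p < n → q < n → p ≢ q → offset n q p ≡ n ∸ offset n p q
offset-comm {n} {p} {q} pn qn ne with <-cmp p q
... | tri≈ _ e _ = ⊥-elim (ne e)
... | tri< lt _ _ rewrite offset-≥ {n} {q} {p} (<⇒≤ lt) | offset-< {n} lt =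
      sym (m∸[m∸n]≡n (≤-trans (m∸n≤m q p) (<⇒≤ qn)))
... | tri> _ _ gt rewrite offset-< {n} gt | offset-≥ {n} {p} {q} (<⇒≤ gt) = refl

abstract
  next : ℕ → ℕ → ℕ
  next n p with suc p ≟ n
  ... | yes _ = 0
  ... | no _ = suc p

  next-wrap : ∀ {n p} → suc p ≡ n → next n p ≡ 0
  next-wrap {n} {p} e with suc p ≟ n
  ... | yes _ = refl
  ... | no ne = ⊥-elim (ne e)

  next-step : ∀ {n p} → suc p ≢ n → next n p ≡ suc p
  next-step {n} {p} e with suc p ≟ n
  ... | yes y = ⊥-elim (e y)
  ... | no ne = refl

prev : ℕ → ℕ → ℕ
prev n zero = n ∸ 1
prev n (suc p) = p

next<n : ∀ {n p} → p < n → next n p < n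
next<n {n} {p} pn with suc p ≟ n
... | yes e rewrite next-wrap e = ≤-trans (s≤s z≤n) pn
... | no ne rewrite next-step ne = ≤∧≢⇒< pn ne

prev<n : ∀ {n p} → p < n → prev n p < n
prev<n {suc n} {zero} pn = ≤-refl
prev<n {n} {suc p} pn = <-trans (n<1+n p) pn

next-prev : ∀ {n p} → p < n → next n (prev n p) ≡ p
next-prev {suc n} {zero} pn = next-wrap refl
next-prev {n} {suc p} pn = next-step (<⇒≢ pn)

offset-next : ∀ {n p q} → p < n → q < n →
  (suc (offset n p q) ≡ n × offset n (next n p) q ≡ 0) ⊎ offset n (next n p) q ≡ suc (offset n p q)
offset-next {n} {p} {q} pn qn with suc p ≟ n
offset-next {n} {p} {q} pn qn | yes e rewrite next-wrap e with q
... | zero rewrite offset-≥ {n} {0} {0} z≤n | offset-≥ {n} {p} {0} z≤n = inj₁ (e , refl)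
... | suc q' rewrite offset-< {n} {0} {suc q'} (s≤s z≤n) | offset-≥ {n} {p} {suc q'} (≤-pred (subst (suc q' <_) (sym e) qn)) =
  inj₂ (trans (cong (_∸ suc q') (sym e)) (+-∸-assoc 1 (≤-pred (subst (suc q' <_) (sym e) qn))))
offset-next {n} {p} {q} pn qn | no ne rewrite next-step ne with q ≤? p
... | yes le rewrite offset-≥ {n} {suc p} {q} (m≤n⇒m≤1+n le) | offset-≥ {n} le = inj₂ (+-∸-assoc 1 le)
... | no nle rewrite offset-< {n} (≰⇒> nle) with q ≟ suc p
... | yes refl rewrite offset-≥ {n} {suc p} {suc p} ≤-refl | n∸n≡0 p | m+n∸n≡m 1 p =
  inj₁ (suc-pred n {{>-nonZero (≤-trans (s≤s z≤n) pn)}} , refl)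
... | no ne2 rewrite offset-< {n} {suc p} {q} (≤∧≢⇒< (≰⇒> nle) (λ x → ne2 (sym x))) =
  inj₂ (trans (m∸n≡1+[m∸1+n] {n} {q ∸ suc p} k<n) (cong (λ z → suc (n ∸ z)) (sym (m∸n≡1+[m∸1+n] (≰⇒> nle)))))
  where
  k<n : suc (q ∸ suc p) ≤ n
  k<n = ≤-trans (≤-reflexive (sym (m∸n≡1+[m∸1+n] (≰⇒> nle)))) (≤-trans (m∸n≤m q p) (<⇒≤ qn))

shorterArc : ℕ → ℕ → ℕ
shorterArc n d = d ⊓ (n ∸ d)

shorterArc≤d : ∀ n d → shorterArc n d ≤ d
shorterArc≤d n d = m⊓n≤m d (n ∸ d)

shorterArc≤n∸d : ∀ n d → shorterArc n d ≤ n ∸ d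
shorterArc≤n∸d n d = m⊓n≤n d (n ∸ d)

m+m≤n⇒m≤n∸m : ∀ {d n} → d + d ≤ n → d ≤ n ∸ d
m+m≤n⇒m≤n∸m {d} {n} le = ≤-trans (≤-reflexive (sym (m+n∸n≡m d d))) (∸-monoˡ-≤ d le)

CycleStep : ℕ → ℕ → ℕ → Set
CycleStep N p p' = (p' ≡ suc p) ⊎ (p ≡ suc p') ⊎ (p ≡ 0 × suc p' ≡ N) ⊎ (p' ≡ 0 × suc p ≡ N)

Neighbour : ℕ → ℕ → ℕ → Set
Neighbour N p p' = p' ≡ next N p ⊎ p' ≡ prev N p

cycleStep⇒neighbour : ∀ {N p p'} → p' < N → CycleStep N p p' → Neighbour N p p'
cycleStep⇒neighbour {N} {p} p'N (inj₁ refl) = inj₁ (sym (next-step (<⇒≢ p'N)))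
cycleStep⇒neighbour _ (inj₂ (inj₁ refl)) = inj₂ refl
cycleStep⇒neighbour {suc N} _ (inj₂ (inj₂ (inj₁ (refl , refl)))) = inj₂ refl
cycleStep⇒neighbour _ (inj₂ (inj₂ (inj₂ (refl , e)))) = inj₁ (sym (next-wrap e))

neighbour⇒cycleStep : ∀ {N p p'} → p < N → Neighbour N p p' → CycleStep N p p'
neighbour⇒cycleStep {N} {p} pN (inj₁ refl) with suc p ≟ N
... | yes e rewrite next-wrap e = inj₂ (inj₂ (inj₂ (refl , e)))
... | no ne rewrite next-step ne = inj₁ refl
neighbour⇒cycleStep {suc N} {zero} pN (inj₂ refl) = inj₂ (inj₂ (inj₁ (refl , refl)))
neighbour⇒cycleStep {N} {suc p} pN (inj₂ refl) = inj₂ (inj₁ refl)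

module OddCycle (t : ℕ) where
  N : ℕ
  N = suc (t + t)

  N∸1+t≡t : N ∸ suc t ≡ t
  N∸1+t≡t = m+n∸m≡n t t

  shorterArc-short : ∀ {d} → d ≤ t → shorterArc N d ≡ d
  shorterArc-short {d} le = m≤n⇒m⊓n≡m (m+m≤n⇒m≤n∸m (≤-trans (+-mono-≤ le le) (n≤1+n _)))

  shorterArc-long : ∀ {d} → t < d → shorterArc N d ≡ N ∸ d
  shorterArc-long {d} lt = m≥n⇒m⊓n≡n (≤-trans (∸-monoˡ-≤ d (+-mono-≤ lt (<⇒≤ lt)))
                     (≤-reflexive (m+n∸n≡m d d)))

  shorterArc≤t : ∀ d → shorterArc N d ≤ t
  shorterArc≤t d with d ≤? t
  ... | yes le = ≤-trans (shorterArc≤d N d) le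
  ... | no nle = ≤-trans (shorterArc≤n∸d N d) (≤-trans (∸-monoʳ-≤ N (≰⇒> nle)) (≤-reflexive N∸1+t≡t))

  shorterArc-suc≤ : ∀ d → shorterArc N (suc d) ≤ suc (shorterArc N d)
  shorterArc-suc≤ d with <-cmp d t
  ... | tri< lt _ _ rewrite shorterArc-short lt | shorterArc-short (<⇒≤ lt) = ≤-refl
  ... | tri≈ _ refl _ rewrite shorterArc-short {d} ≤-refl | shorterArc-long {suc d} ≤-refl | N∸1+t≡t = n≤1+n d
  ... | tri> _ _ gt rewrite shorterArc-long gt | shorterArc-long (m<n⇒m<1+n gt) = ≤-trans (∸-monoʳ-≤ N (n≤1+n d)) (n≤1+n _)

  shorterArc≤suc : ∀ d → shorterArc N d ≤ suc (shorterArc N (suc d))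
  shorterArc≤suc d with <-cmp d t
  ... | tri< lt _ _ rewrite shorterArc-short lt | shorterArc-short (<⇒≤ lt) = ≤-trans (n≤1+n d) (n≤1+n _)
  ... | tri≈ _ refl _ rewrite shorterArc-short {d} ≤-refl | shorterArc-long {suc d} ≤-refl | N∸1+t≡t = n≤1+n d
  ... | tri> _ _ gt rewrite shorterArc-long gt | shorterArc-long (m<n⇒m<1+n gt) = m∸n≤1+[m∸1+n] N d

  shorterArc-complement : ∀ {d} → d ≤ N → shorterArc N (N ∸ d) ≡ shorterArc N d
  shorterArc-complement {d} le rewrite m∸[m∸n]≡n le = ⊓-comm (N ∸ d) d

  shorterArc≡0⇒≡0 : ∀ {d} → d < N → shorterArc N d ≡ 0 → d ≡ 0
  shorterArc≡0⇒≡0 {d} dn e with d ≤? t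
  ... | yes le = trans (sym (shorterArc-short le)) e
  ... | no nle = ⊥-elim (<⇒≱ dn (m∸n≡0⇒m≤n (trans (sym (shorterArc-long (≰⇒> nle))) e)))

  dist : ℕ → ℕ → ℕ
  dist p q = shorterArc N (offset N p q)

  dist≤t : ∀ p q → dist p q ≤ t
  dist≤t p q = shorterArc≤t _

  dist-refl : ∀ p → dist p p ≡ 0
  dist-refl p rewrite offset-self {N} {p} = refl

  dist≡0⇒≡ : ∀ {p q} → p < N → q < N → dist p q ≡ 0 → p ≡ q
  dist≡0⇒≡ {p} {q} pn qn e = offset≡0⇒≡ {N} qn (shorterArc≡0⇒≡0 (offset<n pn qn) e)

  dist-sym : ∀ {p q} → p < N → q < N → dist p q ≡ dist q p
  dist-sym {p} {q} pn qn with p ≟ q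
  ... | yes refl = refl
  ... | no ne rewrite offset-comm pn qn ne = sym (shorterArc-complement (<⇒≤ (offset<n pn qn)))

  Neighbour<N : ∀ {p p'} → p < N → Neighbour N p p' → p' < N
  Neighbour<N pn (inj₁ refl) = next<n pn
  Neighbour<N pn (inj₂ refl) = prev<n pn

  dist-neighbour≤ : ∀ {p p' q} → p < N → q < N → Neighbour N p p' → dist p q ≤ suc (dist p' q)
  dist-neighbour≤ {p} {p'} {q} pn qn (inj₁ refl) with offset-next {N} {p} {q} pn qn
  ... | inj₁ (e , e') = ≤-trans (shorterArc≤n∸d N (offset N p q))
         (≤-trans (≤-reflexive (trans (cong (_∸ offset N p q) (sym e)) (m+n∸n≡m 1 (offset N p q)))) (s≤s z≤n))
  ... | inj₂ e rewrite e = shorterArc≤suc (offset N p q)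
  dist-neighbour≤ {p} {p'} {q} pn qn (inj₂ refl) with offset-next {N} {prev N p} {q} (prev<n pn) qn
  ... | inj₁ (_ , e) rewrite next-prev {N} pn | e = z≤n
  ... | inj₂ e rewrite next-prev {N} pn | e = shorterArc-suc≤ _

  dist-descent : ∀ {p q} → p < N → q < N → p ≢ q → Σ ℕ λ p' → Neighbour N p p' × suc (dist p' q) ≡ dist p q
  dist-descent {p} {q} pn qn ne with offset N p q ≤? t
  ... | yes le with offset-next {N} {prev N p} {q} (prev<n pn) qn
  ...   | inj₁ (_ , e) rewrite next-prev {N} pn = ⊥-elim (ne (offset≡0⇒≡ {N} qn e))
  ...   | inj₂ e rewrite next-prev {N} pn =
           prev N p , inj₂ refl , trans (cong suc (shorterArc-short (≤-trans (n≤1+n _) (≤-trans (≤-reflexive (sym e)) le))))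
                 (trans (sym e) (sym (shorterArc-short le)))
  dist-descent {p} {q} pn qn ne | no nle with offset-next {N} {p} {q} pn qn
  ... | inj₁ (e1 , e2) = next N p , inj₁ refl ,
         trans (cong (λ z → suc (shorterArc N z)) e2) (sym (trans (shorterArc-long (≰⇒> nle))
           (trans (cong (_∸ offset N p q) (sym e1)) (m+n∸n≡m 1 (offset N p q)))))
  ... | inj₂ e = next N p , inj₁ refl ,
         trans (cong (λ z → suc (shorterArc N z)) e)
          (trans (cong suc (shorterArc-long (m<n⇒m<1+n (≰⇒> nle))))
           (sym (trans (shorterArc-long (≰⇒> nle)) (m∸n≡1+[m∸1+n] (subst (_≤ N) e (<⇒≤ (offset<n (next<n pn) qn)))))))

  dist-ascent : ∀ {p q} → 1 ≤ t → p < N → q < N → dist p q < t →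
    Σ ℕ λ p' → Neighbour N p p' × dist p' q ≡ suc (dist p q)
  dist-ascent {p} {q} t≥1 pn qn lt with suc (offset N p q) ≤? t
  ... | yes le with offset-next {N} {p} {q} pn qn
  ...   | inj₁ (e1 , _) = ⊥-elim (<⇒≱ (s≤s (m≤m+n t t)) (subst (_≤ t) e1 le))
  ...   | inj₂ e = next N p , inj₁ refl ,
    trans (cong (shorterArc N) e) (trans (shorterArc-short le) (cong suc (sym (shorterArc-short (≤-trans (n≤1+n _) le)))))
  dist-ascent {p} {q} t≥1 pn qn lt | no nle with offset N p q ≟ t | offset N p q ≟ suc t
  ... | yes e | _ = ⊥-elim (<-irrefl (trans (cong (shorterArc N) e) (shorterArc-short ≤-refl)) lt)
  ... | no _ | yes e = ⊥-elim (<-irrefl (trans (cong (shorterArc N) e) (trans (shorterArc-long ≤-refl) N∸1+t≡t)) lt)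
  ... | no ne1 | no ne2 with offset-next {N} {prev N p} {q} (prev<n pn) qn
  ...   | inj₁ (_ , e) rewrite next-prev {N} pn = ⊥-elim (nle (subst (λ z → suc z ≤ t) (sym e) t≥1))
  ...   | inj₂ e rewrite next-prev {N} pn = prev N p , inj₂ refl , goal
    where
    c' = offset N (prev N p) q
    tc : t < c'
    tc = ≤-pred (subst (suc (suc t) ≤_) e
           (≤∧≢⇒< (≤∧≢⇒< (≤-pred (≰⇒> nle)) (λ x → ne1 (sym x))) (λ x → ne2 (sym x))))
    goal : shorterArc N c' ≡ suc (shorterArc N (offset N p q))
    goal = trans (shorterArc-long tc) (trans (m∸n≡1+[m∸1+n] (subst (_≤ N) e (<⇒≤ (offset<n pn qn))))
             (cong suc (sym (trans (cong (shorterArc N) e) (shorterArc-long (m<n⇒m<1+n tc))))))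

  dist-antipodal : ∀ {p q} → q ≤ p → (p ∸ q ≡ t ⊎ p ∸ q ≡ suc t) → dist p q ≡ t
  dist-antipodal {p} {q} le (inj₁ e) rewrite offset-≥ {N} le | e = shorterArc-short ≤-refl
  dist-antipodal {p} {q} le (inj₂ e) rewrite offset-≥ {N} le | e = trans (shorterArc-long ≤-refl) N∸1+t≡t

  dist≤∸ : ∀ {p q} → q ≤ p → dist p q ≤ p ∸ q
  dist≤∸ {p} {q} le rewrite offset-≥ {N} le = shorterArc≤d N (p ∸ q)

  dist≤N∸∸ : ∀ {p q} → q ≤ p → dist p q ≤ N ∸ (p ∸ q)
  dist≤N∸∸ {p} {q} le rewrite offset-≥ {N} le = shorterArc≤n∸d N (p ∸ q)

  ∸<t : ∀ {a b} → b ≤ a → a ≤ t + t → suc (suc t) ≤ b → a ∸ b < t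
  ∸<t {a} {b} ba at tb with t ≤? a ∸ b
  ... | no nle = ≰⇒> nle
  ... | yes le = ⊥-elim (<⇒≱ tb (≤-trans (+-cancelˡ-≤ t b t
                   (≤-trans (≤-trans (+-monoˡ-≤ b le) (≤-reflexive (m∸n+n≡m ba))) at)) (n≤1+n t)))

  N∸<t : ∀ {q} → q < N → suc (suc t) ≤ q → N ∸ q < t
  N∸<t {q} qn tq with t ≤? N ∸ q
  ... | no nle = ≰⇒> nle
  ... | yes le = ⊥-elim (<⇒≱ tq (+-cancelˡ-≤ t q (suc t)
                   (≤-trans (≤-trans (+-monoˡ-≤ q le) (≤-reflexive (m∸n+n≡m (<⇒≤ qn)))) (≤-reflexive (sym (+-suc t t))))))

  dist-from-0<t : ∀ {q} → q < N → suc (suc t) ≤ q → dist q 0 < t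
  dist-from-0<t {q} qn tq = ≤-<-trans (dist≤N∸∸ z≤n) (N∸<t qn tq)

  dist-long<t : ∀ {p q} → p < N → q < N → q ≤ p → suc (suc t) ≤ q → dist p q < t
  dist-long<t {p} {q} pn qn qp tq = ≤-<-trans (dist≤∸ qp) (∸<t qp (≤-pred pn) tq)

  UpperArc : ℕ → Set
  UpperArc p = p ≡ 0 ⊎ suc (suc t) ≤ p

  -- The arc t + 2, …, 2t, 0 has only t − 1 edges.
  dist<t-UpperArc : ∀ {p q} → p < N → q < N → p ≢ q → UpperArc p → UpperArc q → dist p q < t
  dist<t-UpperArc pn qn ne (inj₁ refl) (inj₁ refl) = ⊥-elim (ne refl)
  dist<t-UpperArc pn qn ne (inj₁ refl) (inj₂ tq) = subst (_< t) (dist-sym qn pn) (dist-from-0<t qn tq)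
  dist<t-UpperArc pn qn ne (inj₂ tp) (inj₁ refl) = dist-from-0<t pn tp
  dist<t-UpperArc {p} {q} pn qn ne (inj₂ tp) (inj₂ tq) with q ≤? p
  ... | yes qp = dist-long<t pn qn qp tq
  ... | no nqp = subst (_< t) (dist-sym qn pn) (dist-long<t qn pn (<⇒≤ (≰⇒> nqp)) tp)

-- Sums, and vertex covers of paths

bit : Bool → ℕ
bit true  = 1
bit false = 0

bit-∨ : ∀ a b → bit (a ∨ b) ≤ bit a + bit b
bit-∨ true b = s≤s z≤n
bit-∨ false b = ≤-refl

≡ᵇ-true⇒≡ : ∀ {a b} → (a ≡ᵇ b) ≡ true → a ≡ b
≡ᵇ-true⇒≡ {a} {b} e = ≡ᵇ⇒≡ a b (subst T (sym e) tt)

T⇒1≤bit : ∀ {b} → T b → 1 ≤ bit b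
T⇒1≤bit {true} _ = ≤-refl

-- Positions on a cycle are naturals, so sums over them are indexed by ℕ.
sumBelow : ℕ → (ℕ → ℕ) → ℕ
sumBelow zero    f = 0
sumBelow (suc k) f = f 0 + sumBelow k (λ x → f (suc x))

∑-toℕ : ∀ k f → ∑[ i < k ] f (toℕ i) ≡ sumBelow k f
∑-toℕ zero    f = refl
∑-toℕ (suc k) f = cong (f 0 +_) (∑-toℕ k (λ x → f (suc x)))

∑-mono-≤ : ∀ k {f g : Fin k → ℕ} → (∀ i → f i ≤ g i) → ∑[ i < k ] f i ≤ ∑[ i < k ] g i
∑-mono-≤ zero    le = z≤n
∑-mono-≤ (suc k) le = +-mono-≤ (le zero) (∑-mono-≤ k (λ i → le (suc i)))

∑-suc : ∀ k (f : Fin k → ℕ) → ∑[ i < k ] suc (f i) ≡ ∑[ i < k ] f i + k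
∑-suc zero    f = refl
∑-suc (suc k) f = begin
  suc (f zero + ∑[ i < k ] suc (f (suc i)))  ≡⟨ cong (λ s → suc (f zero + s)) (∑-suc k (λ i → f (suc i))) ⟩
  suc (f zero + (∑[ i < k ] f (suc i) + k))  ≡⟨ cong suc (+-assoc (f zero) _ k) ⟨
  suc (f zero + ∑[ i < k ] f (suc i) + k)    ≡⟨ +-suc _ k ⟨
  f zero + ∑[ i < k ] f (suc i) + suc k      ∎
  where open ≡-Reasoning

∑-const-1 : ∀ k → ∑[ i < k ] 1 ≡ k
∑-const-1 zero    = refl
∑-const-1 (suc k) = cong suc (∑-const-1 k)

∑-notFirst : ∀ k → ∑[ i < k ] (if toℕ i ≡ᵇ 0 then 0 else 1) ≡ k ∸ 1
∑-notFirst zero    = refl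
∑-notFirst (suc k) = ∑-const-1 k

sum-tabulate : ∀ k (f : Fin k → ℕ) → ListAction.sum (tabulate f) ≡ ∑[ i < k ] f i
sum-tabulate zero    f = refl
sum-tabulate (suc k) f = cong (f zero +_) (sum-tabulate k (λ i → f (suc i)))

length-concat-tabulate : ∀ {A : Set} k (g : Fin k → List A) →
  length (concat (tabulate g)) ≡ ∑[ i < k ] length (g i)
length-concat-tabulate zero    g = refl
length-concat-tabulate (suc k) g =
  trans (length-++ (g zero)) (cong (length (g zero) +_) (length-concat-tabulate k (λ i → g (suc i))))

∈-concat-tabulate : ∀ {A : Set} {x : A} {k} (g : Fin k → List A) i → x ∈ g i → x ∈ concat (tabulate g)
∈-concat-tabulate g i x∈gi = ∈-concat⁺′ x∈gi (∈-tabulate⁺ i)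

sumBelow-split : ∀ a b f → sumBelow (a + b) f ≡ sumBelow a f + sumBelow b (λ k → f (a + k))
sumBelow-split zero    b f = refl
sumBelow-split (suc a) b f =
  trans (cong (f 0 +_) (sumBelow-split a b (λ x → f (suc x)))) (sym (+-assoc (f 0) _ _))

sumBelow-last : ∀ k f → sumBelow (suc k) f ≡ sumBelow k f + f k
sumBelow-last zero    f = +-comm (f 0) 0
sumBelow-last (suc k) f =
  trans (cong (f 0 +_) (sumBelow-last k (λ x → f (suc x)))) (sym (+-assoc (f 0) _ _))

sumBelow-distrib-+ : ∀ k f g → sumBelow k (λ x → f x + g x) ≡ sumBelow k f + sumBelow k g
sumBelow-distrib-+ k f g = begin
  sumBelow k (λ x → f x + g x)                             ≡⟨ ∑-toℕ k _ ⟨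
  ∑[ i < k ] (f (toℕ i) + g (toℕ i))                       ≡⟨ ∑-distrib-+ {k} (λ i → f (toℕ i)) (λ i → g (toℕ i)) ⟩
  ∑[ i < k ] f (toℕ i) + ∑[ i < k ] g (toℕ i)              ≡⟨ cong₂ _+_ (∑-toℕ k f) (∑-toℕ k g) ⟩
  sumBelow k f + sumBelow k g                              ∎
  where open ≡-Reasoning

sumBelow-mono : ∀ k {f g} → (∀ x → x < k → f x ≤ g x) → sumBelow k f ≤ sumBelow k g
sumBelow-mono zero    le = z≤n
sumBelow-mono (suc k) le = +-mono-≤ (le 0 z<s) (sumBelow-mono k (λ x lt → le (suc x) (s≤s lt)))

sumBelow-cong : ∀ k {f g} → (∀ x → x < k → f x ≡ g x) → sumBelow k f ≡ sumBelow k g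
sumBelow-cong zero    e = refl
sumBelow-cong (suc k) e = cong₂ _+_ (e 0 z<s) (sumBelow-cong k (λ x lt → e (suc x) (s≤s lt)))

sumBelow-zero : ∀ k → sumBelow k (λ _ → 0) ≡ 0
sumBelow-zero zero    = refl
sumBelow-zero (suc k) = sumBelow-zero k

sumBelow-count-< : ∀ k c → c ≤ k → sumBelow k (λ x → bit (x <ᵇ c)) ≡ c
sumBelow-count-< zero    zero    z≤n      = refl
sumBelow-count-< (suc k) zero    _        = sumBelow-zero k
sumBelow-count-< (suc k) (suc c) (s≤s le) = cong suc (sumBelow-count-< k c le)

sumBelow-count-≡ : ∀ k c → c < k → sumBelow k (λ x → bit (x ≡ᵇ c)) ≡ 1
sumBelow-count-≡ (suc k) zero    _        = cong suc (sumBelow-zero k)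
sumBelow-count-≡ (suc k) (suc c) (s≤s lt) = sumBelow-count-≡ k c lt

sumBelow-count-≡≤1 : ∀ k c → sumBelow k (λ x → bit (x ≡ᵇ c)) ≤ 1
sumBelow-count-≡≤1 zero    c       = z≤n
sumBelow-count-≡≤1 (suc k) zero    = s≤s (≤-reflexive (sumBelow-zero k))
sumBelow-count-≡≤1 (suc k) (suc c) = sumBelow-count-≡≤1 k c

-- Vertex sets are given by 0/1 indicators G : ℕ → ℕ.
CoversEdge : (ℕ → ℕ) → ℕ → ℕ → Set
CoversEdge G a b = 1 ≤ G a ⊎ 1 ≤ G b

≱1⇒≡0 : ∀ {x} → ¬ (1 ≤ x) → x ≡ 0
≱1⇒≡0 = n<1⇒n≡0 ∘ ≰⇒>

covered⇒1≤+ : ∀ {a b} → 1 ≤ a ⊎ 1 ≤ b → 1 ≤ a + b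
covered⇒1≤+ {a} (inj₁ 1≤a) = ≤-trans 1≤a (m≤m+n a _)
covered⇒1≤+ {a} (inj₂ 1≤b) = ≤-trans 1≤b (m≤n+m _ a)

-- Vertex covers of the path  Q 0 — P 0 — Q 1 — P 1 — … — Q k — P k.
path-cover : ∀ k (P Q : ℕ → ℕ) →
  (∀ b → b < suc k → 1 ≤ P b ⊎ 1 ≤ Q b) → (∀ b → suc b < suc k → 1 ≤ Q (suc b) ⊎ 1 ≤ P b) →
  suc k ≤ sumBelow (suc k) (λ b → P b + Q b) ×
  (1 ≤ P k → 1 ≤ Q 0 → suc (suc k) ≤ sumBelow (suc k) (λ b → P b + Q b))
path-cover zero P Q edge _ =
  ≤-trans (covered⇒1≤+ (edge 0 z<s)) (m≤m+n _ 0) , λ p q → ≤-trans (+-mono-≤ p q) (m≤m+n _ 0)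
path-cover (suc k) P Q edge link
  with path-cover k (λ b → P (suc b)) (λ b → Q (suc b)) (λ b lt → edge (suc b) (s≤s lt)) (λ b lt → link (suc b) (s≤s lt))
... | rest , rest-ends with 1 ≤? P 0
... | yes p0 = +-mono-≤ (covered⇒1≤+ (inj₁ p0)) rest , λ _ q0 → +-mono-≤ (+-mono-≤ p0 q0) rest
... | no ¬p0 = +-mono-≤ first rest , λ pk _ → +-mono-≤ first (rest-ends pk q1)
  where
  first : 1 ≤ P 0 + Q 0
  first = covered⇒1≤+ (edge 0 z<s)
  q1 : 1 ≤ Q 1
  q1 = [ id , ⊥-elim ∘ ¬p0 ]′ (link 0 (s≤s (s≤s z≤n)))

cycleSum : ℕ → (ℕ → ℕ) → ℕ
cycleSum T G = G 0 + (sumBelow T (λ b → G (suc b)) + sumBelow T (λ b → G (suc (T + b))))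

sumBelow-cycleSum : ∀ T G → sumBelow (suc (T + T)) G ≡ cycleSum T G
sumBelow-cycleSum T G = cong (G 0 +_) (sumBelow-split T T (λ x → G (suc x)))

-- The antipodal pairs of the cycle of length 2T + 1 are at offset T (short) or
-- T + 1 (long); with the cut positions removed (0 for the last cycle, T + 1 for
-- the first, both for a middle one) the remaining ones form a path.
CoversShort CoversLong : ℕ → (ℕ → ℕ) → ℕ → Set
CoversShort T G b = CoversEdge G (suc b) (suc (T + b))
CoversLong  T G b = CoversEdge G (suc (suc (T + b))) (suc b)

CoversShort-suc : ∀ {T G b} → CoversShort T G (suc b) → CoversEdge G (suc (suc b)) (suc (suc (T + b)))
CoversShort-suc {T} {G} {b} = subst (λ z → CoversEdge G (suc (suc b)) (suc z)) (+-suc T b)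

last-cycle-cover : ∀ T G → 1 ≤ T →
  (∀ b → b < T → CoversShort T G b) → (∀ b → suc b < T → CoversLong T G b) →
  T ≤ cycleSum T G × (cycleSum T G ≤ T → G T ≡ 0 ⊎ G (suc T) ≡ 0)
last-cycle-cover T@(suc s) G _ short long = ≤-trans lower (m≤n+m _ (G 0)) , tight
  where
  low high : ℕ → ℕ
  low b = G (suc b)
  high b = G (suc (T + b))
  link : ∀ b → suc b < T → 1 ≤ high (suc b) ⊎ 1 ≤ low b
  link b lt = subst (λ z → CoversEdge G (suc z) (suc b)) (sym (+-suc T b)) (long b lt)
  path = path-cover s low high short link
  arcs : sumBelow T (λ b → low b + high b) ≡ sumBelow T low + sumBelow T high
  arcs = sumBelow-distrib-+ T low high
  lower : T ≤ sumBelow T low + sumBelow T high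
  lower = subst (T ≤_) arcs (proj₁ path)
  tight : cycleSum T G ≤ T → G T ≡ 0 ⊎ G (suc T) ≡ 0
  tight le with 1 ≤? G T | 1 ≤? G (suc T)
  ... | no ¬p | _     = inj₁ (≱1⇒≡0 ¬p)
  ... | yes _ | no ¬q = inj₂ (≱1⇒≡0 ¬q)
  ... | yes p | yes q = ⊥-elim (<-irrefl refl
        (≤-trans (subst (suc T ≤_) arcs (proj₂ path p (subst (λ z → 1 ≤ G (suc z)) (sym (+-identityʳ T)) q)))
                 (≤-trans (m≤n+m _ (G 0)) le)))

first-cycle-cover : ∀ T G → 1 ≤ T →
  (∀ b → b < T → b ≢ 0 → CoversShort T G b) → (∀ b → suc b < T → CoversLong T G b) → CoversEdge G 0 T →
  T ≤ cycleSum T G × (cycleSum T G ≤ T → G 0 ≡ 0 ⊎ G 1 ≡ 0)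
first-cycle-cover T@(suc s) G _ short long edge₀ = ≤-trans (proj₁ path) bound , tight
  where
  -- the path ends with the edge {T , 0}, so its last P-vertex is position 0
  far : ℕ → ℕ
  far b with suc b <? T
  ... | yes _ = suc (suc (T + b))
  ... | no _  = 0
  far-< : ∀ b → suc b < T → far b ≡ suc (suc (T + b))
  far-< b lt with suc b <? T
  ... | yes _  = refl
  ... | no ¬lt = contradiction lt ¬lt
  far-last : far s ≡ 0
  far-last with suc s <? T
  ... | yes lt = contradiction lt (n≮n T)
  ... | no _   = refl
  P Q : ℕ → ℕ
  P b = G (far b)
  Q b = G (suc b)
  edge′ : ∀ b → b < T → 1 ≤ P b ⊎ 1 ≤ Q b
  edge′ b lt with m≤n⇒m<n∨m≡n (≤-pred lt)
  ... | inj₁ l    = subst (λ z → 1 ≤ G z ⊎ 1 ≤ Q b) (sym (far-< b (s≤s l))) (long b (s≤s l))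
  ... | inj₂ refl = subst (λ z → 1 ≤ G z ⊎ 1 ≤ G T) (sym far-last) edge₀
  link′ : ∀ b → suc b < T → 1 ≤ Q (suc b) ⊎ 1 ≤ P b
  link′ b lt = subst (λ z → 1 ≤ Q (suc b) ⊎ 1 ≤ G z) (sym (far-< b lt))
                 (CoversShort-suc {T} {G} {b} (short (suc b) lt 1+n≢0))
  path = path-cover s P Q edge′ link′
  high-shift : sumBelow s (λ b → G (suc (suc (T + b)))) ≤ sumBelow T (λ b → G (suc (T + b)))
  high-shift = ≤-trans (≤-reflexive (sumBelow-cong s (λ b _ → cong (λ z → G (suc z)) (sym (+-suc T b)))))
                       (m≤n+m _ (G (suc (T + 0))))
  sumP : sumBelow T P ≤ G 0 + sumBelow T (λ b → G (suc (T + b)))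
  sumP = begin
    sumBelow T P                                     ≡⟨ sumBelow-last s P ⟩
    sumBelow s P + G (far s)                         ≡⟨ cong₂ _+_ (sumBelow-cong s (λ b lt → cong G (far-< b (s≤s lt))))
                                                                   (cong G far-last) ⟩
    sumBelow s (λ b → G (suc (suc (T + b)))) + G 0   ≡⟨ +-comm _ (G 0) ⟩
    G 0 + sumBelow s (λ b → G (suc (suc (T + b))))   ≤⟨ +-monoʳ-≤ (G 0) high-shift ⟩
    G 0 + sumBelow T (λ b → G (suc (T + b)))         ∎
    where open ≤-Reasoning
  bound : sumBelow T (λ b → P b + Q b) ≤ cycleSum T G
  bound = begin
    sumBelow T (λ b → P b + Q b)                                       ≡⟨ sumBelow-distrib-+ T P Q ⟩
    sumBelow T P + sumBelow T Q                                        ≤⟨ +-monoˡ-≤ _ sumP ⟩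
    G 0 + sumBelow T (λ b → G (suc (T + b))) + sumBelow T Q            ≡⟨ +-assoc (G 0) _ _ ⟩
    G 0 + (sumBelow T (λ b → G (suc (T + b))) + sumBelow T Q)          ≡⟨ cong (G 0 +_) (+-comm _ (sumBelow T Q)) ⟩
    cycleSum T G                                                       ∎
    where open ≤-Reasoning
  tight : cycleSum T G ≤ T → G 0 ≡ 0 ⊎ G 1 ≡ 0
  tight le with 1 ≤? G 0 | 1 ≤? G 1
  ... | no ¬p | _     = inj₁ (≱1⇒≡0 ¬p)
  ... | yes _ | no ¬q = inj₂ (≱1⇒≡0 ¬q)
  ... | yes p | yes q = ⊥-elim (<-irrefl refl
        (≤-trans (≤-trans (proj₂ path (subst (λ z → 1 ≤ G z) (sym far-last) p) q) bound) le))

middle-cycle-cover : ∀ T G → 2 ≤ T →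
  (∀ b → b < T → b ≢ 0 → CoversShort T G b) → (∀ b → suc b < T → CoversLong T G b) →
  T ∸ 1 ≤ cycleSum T G × (cycleSum T G ≤ T ∸ 1 → G 1 ≡ 0 × G T ≡ 0)
middle-cycle-cover (suc zero) G (s≤s ())
middle-cycle-cover T@(suc s@(suc s′)) G _ short long = ≤-trans (proj₁ path) bound , tight
  where
  P Q : ℕ → ℕ
  P b = G (suc (suc (T + b)))
  Q b = G (suc b)
  path = path-cover s′ P Q (λ b lt → long b (s≤s lt))
           (λ b lt → CoversShort-suc {T} {G} {b} (short (suc b) (m≤n⇒m≤1+n lt) 1+n≢0))
  high-shift : sumBelow s P ≤ sumBelow T (λ b → G (suc (T + b)))
  high-shift = ≤-trans (≤-reflexive (sumBelow-cong s (λ b _ → cong (λ z → G (suc z)) (sym (+-suc T b)))))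
                       (m≤n+m _ (G (suc (T + 0))))
  bound-with-T : G T + sumBelow s (λ b → P b + Q b) ≤ cycleSum T G
  bound-with-T = begin
    G T + sumBelow s (λ b → P b + Q b)                    ≡⟨ cong (G T +_) (sumBelow-distrib-+ s P Q) ⟩
    G T + (sumBelow s P + sumBelow s Q)                   ≡⟨ cong (G T +_) (+-comm (sumBelow s P) _) ⟩
    G T + (sumBelow s Q + sumBelow s P)                   ≡⟨ +-assoc (G T) _ _ ⟨
    G T + sumBelow s Q + sumBelow s P                     ≡⟨ cong (_+ sumBelow s P) (trans (+-comm (G T) _) (sym (sumBelow-last s Q))) ⟩
    sumBelow T Q + sumBelow s P                           ≤⟨ +-monoʳ-≤ (sumBelow T Q) high-shift ⟩
    sumBelow T Q + sumBelow T (λ b → G (suc (T + b)))     ≤⟨ m≤n+m _ (G 0) ⟩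
    cycleSum T G                                          ∎
    where open ≤-Reasoning
  bound : sumBelow s (λ b → P b + Q b) ≤ cycleSum T G
  bound = ≤-trans (m≤n+m _ (G T)) bound-with-T
  tight : cycleSum T G ≤ s → G 1 ≡ 0 × G T ≡ 0
  tight le with 1 ≤? G T
  ... | yes gT = ⊥-elim (<-irrefl refl (≤-trans (+-mono-≤ gT (proj₁ path)) (≤-trans bound-with-T le)))
  ... | no ¬gT with 1 ≤? G 1
  ...   | no ¬g1 = ≱1⇒≡0 ¬g1 , ≱1⇒≡0 ¬gT
  ...   | yes g1 = ⊥-elim (<-irrefl refl (≤-trans (≤-trans (proj₂ path far-end g1) bound) le))
    where
    far-end : 1 ≤ P s′
    far-end = [ ⊥-elim ∘ ¬gT , id ]′ (CoversShort-suc {T} {G} {s′} (short s ≤-refl 1+n≢0))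

∑+tight≤∑ : ∀ k (c b : Fin k → ℕ) → (∀ i → b i ≤ c i) →
  (∀ i j → toℕ i < toℕ j → c i ≤ b i → c j ≤ b j → ⊥) →
  ∑[ i < k ] b i + (k ∸ 1) ≤ ∑[ i < k ] c i
∑+tight≤∑ zero    c b b≤c tight² = z≤n
∑+tight≤∑ (suc k) c b b≤c tight² with c zero ≤? b zero
... | yes tight₀ = begin
  b zero + ∑[ i < k ] b (suc i) + k       ≡⟨ +-assoc (b zero) _ k ⟩
  b zero + (∑[ i < k ] b (suc i) + k)     ≡⟨ cong (b zero +_) (∑-suc k (λ i → b (suc i))) ⟨
  b zero + ∑[ i < k ] suc (b (suc i))     ≤⟨ +-mono-≤ (b≤c zero) (∑-mono-≤ k slack) ⟩
  c zero + ∑[ i < k ] c (suc i)           ∎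
  where
  open ≤-Reasoning
  slack : ∀ i → suc (b (suc i)) ≤ c (suc i)
  slack i with c (suc i) ≤? b (suc i)
  ... | yes tightᵢ = ⊥-elim (tight² zero (suc i) z<s tight₀ tightᵢ)
  ... | no ¬tightᵢ = ≰⇒> ¬tightᵢ
... | no ¬tight₀ = begin
  b zero + ∑[ i < k ] b (suc i) + k              ≤⟨ +-monoʳ-≤ _ (m≤n+m∸n k 1) ⟩
  b zero + ∑[ i < k ] b (suc i) + suc (k ∸ 1)    ≡⟨ +-suc _ (k ∸ 1) ⟩
  suc (b zero + ∑[ i < k ] b (suc i) + (k ∸ 1))  ≡⟨ cong suc (+-assoc (b zero) _ _) ⟩
  suc (b zero) + (∑[ i < k ] b (suc i) + (k ∸ 1)) ≤⟨ +-mono-≤ (≰⇒> ¬tight₀) rest ⟩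
  c zero + ∑[ i < k ] c (suc i)                  ∎
  where
  open ≤-Reasoning
  rest = ∑+tight≤∑ k (λ i → c (suc i)) (λ i → b (suc i)) (λ i → b≤c (suc i))
           (λ i j lt → tight² (suc i) (suc j) (s≤s lt))

-- Distances in the chain cycle

[2t+1]/2≡t : ∀ t → suc (t + t) / 2 ≡ t
[2t+1]/2≡t zero    = refl
[2t+1]/2≡t (suc t) =
  trans (m/n≡1+[m∸n]/n {m = suc (suc (t + suc t))} {n = 2} (s≤s (s≤s z≤n)))
        (cong suc (trans (cong (_/ 2) (+-suc t t)) ([2t+1]/2≡t t)))

[2t+1∸2]/2≡t∸1 : ∀ t → 1 ≤ t → (suc (t + t) ∸ 2) / 2 ≡ t ∸ 1
[2t+1∸2]/2≡t∸1 (suc s) _ rewrite +-suc s s = [2t+1]/2≡t s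

[2t+1+1]/2≡1+t : ∀ t → (suc (t + t) + 1) / 2 ≡ suc t
[2t+1+1]/2≡1+t t = trans (cong (_/ 2) (2t+2≡[1+t]*2 t)) (m*n/n≡m (suc t) 2)
  where
  2t+2≡[1+t]*2 : ∀ t → suc (t + t) + 1 ≡ suc t * 2
  2t+2≡[1+t]*2 = solve-∀

module Geometry (m : ℕ) (n : Fin m → ℕ) (t : Fin m → ℕ)
         (n≡2t+1 : ∀ i → n i ≡ suc (t i + t i)) (t≥1 : ∀ i → 1 ≤ t i) where
  open Chain m n

  cdist : Fin m → ℕ → ℕ → ℕ
  cdist i = OddCycle.dist (t i)

  pos<N : ∀ {i} (p : Fin (n i)) → toℕ p < OddCycle.N (t i)
  pos<N {i} p = subst (toℕ p <_) (n≡2t+1 i) (toℕ<n p)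

  1+t<N : ∀ i → suc (t i) < OddCycle.N (t i)
  1+t<N i = s≤s (+-monoˡ-≤ (t i) (t≥1 i))

  0<N : ∀ i → 0 < OddCycle.N (t i)
  0<N i = s≤s z≤n

  t′ : ℕ → ℕ
  t′ k with k <? m
  ... | yes lt = t (fromℕ< lt)
  ... | no _ = 0

  t′-toℕ : ∀ i → t′ (toℕ i) ≡ t i
  t′-toℕ i with toℕ i <? m
  ... | yes lt = cong t (fromℕ<-toℕ i lt)
  ... | no nlt = ⊥-elim (nlt (toℕ<n i))

  prefix : ℕ → ℕ
  prefix zero = 0
  prefix (suc k) = prefix k + t′ k

  prefix-mono : ∀ {a b} → a ≤ b → prefix a ≤ prefix b
  prefix-mono {a} {zero} z≤n = ≤-refl
  prefix-mono {a} {suc b} le with m≤n⇒m<n∨m≡n le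
  ... | inj₁ lt = ≤-trans (prefix-mono (≤-pred lt)) (m≤m+n (prefix b) (t′ b))
  ... | inj₂ refl = ≤-refl

  -- Σ_{a < k < b} t k: a path from cycle a to cycle b crosses each cycle k in
  -- between from its entry 0 to its exit t k + 1, which are at distance t k.
  between : ℕ → ℕ → ℕ
  between a b = prefix b ∸ prefix (suc a)

  between-stepˡ : ∀ {a b} → suc a < b → between a b ≡ t′ (suc a) + between (suc a) b
  between-stepˡ {a} {b} lt = sym (trans (cong (t′ (suc a) +_) (sym (∸-+-assoc (prefix b) (prefix (suc a)) (t′ (suc a)))))
     (m+[n∸m]≡n (m+n≤o⇒m≤o∸n (t′ (suc a)) (subst (_≤ prefix b) (+-comm (prefix (suc a)) (t′ (suc a))) (prefix-mono lt)))))

  between-adjacent : ∀ a → between a (suc a) ≡ 0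
  between-adjacent a = n∸n≡0 (prefix (suc a))

  between-stepʳ : ∀ {a b} → a < b → between a (suc b) ≡ between a b + t′ b
  between-stepʳ {a} {b} lt = +-∸-comm (t′ b) (prefix-mono lt)

  -- Shortest paths from cycle i to y leave cycle i at position exit i y (they
  -- stay in cycle i if y lies on it) and then have length beyond i y.
  abstract
    exit : Fin m → D → ℕ
    exit i (j , q) with <-cmp (toℕ i) (toℕ j)
    ... | tri< _ _ _ = suc (t i)
    ... | tri≈ _ _ _ = toℕ q
    ... | tri> _ _ _ = 0

    beyond : Fin m → D → ℕ
    beyond i (j , q) with <-cmp (toℕ i) (toℕ j)
    ... | tri< _ _ _ = between (toℕ i) (toℕ j) + cdist j 0 (toℕ q)
    ... | tri≈ _ _ _ = 0
    ... | tri> _ _ _ = cdist j (toℕ q) (suc (t j)) + between (toℕ j) (toℕ i)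

    exit-< : ∀ {i j q} → toℕ i < toℕ j → exit i (j , q) ≡ suc (t i)
    exit-< {i} {j} {q} lt with <-cmp (toℕ i) (toℕ j)
    ... | tri< _ _ _ = refl
    ... | tri≈ _ e _ = ⊥-elim (<⇒≢ lt e)
    ... | tri> _ _ gt = ⊥-elim (<⇒≱ lt (<⇒≤ gt))

    exit-≡ : ∀ {i q} → exit i (i , q) ≡ toℕ q
    exit-≡ {i} {q} with <-cmp (toℕ i) (toℕ i)
    ... | tri< lt _ _ = ⊥-elim (<-irrefl refl lt)
    ... | tri≈ _ e _ = refl
    ... | tri> _ _ gt = ⊥-elim (<-irrefl refl gt)

    exit-> : ∀ {i j q} → toℕ j < toℕ i → exit i (j , q) ≡ 0
    exit-> {i} {j} {q} gt with <-cmp (toℕ i) (toℕ j)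
    ... | tri< lt _ _ = ⊥-elim (<⇒≱ lt (<⇒≤ gt))
    ... | tri≈ _ e _ = ⊥-elim (<⇒≢ gt (sym e))
    ... | tri> _ _ _ = refl

    beyond-< : ∀ {i j q} → toℕ i < toℕ j → beyond i (j , q) ≡ between (toℕ i) (toℕ j) + cdist j 0 (toℕ q)
    beyond-< {i} {j} {q} lt with <-cmp (toℕ i) (toℕ j)
    ... | tri< _ _ _ = refl
    ... | tri≈ _ e _ = ⊥-elim (<⇒≢ lt e)
    ... | tri> _ _ gt = ⊥-elim (<⇒≱ lt (<⇒≤ gt))

    beyond-≡ : ∀ {i q} → beyond i (i , q) ≡ 0
    beyond-≡ {i} {q} with <-cmp (toℕ i) (toℕ i)
    ... | tri< lt _ _ = ⊥-elim (<-irrefl refl lt)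
    ... | tri≈ _ e _ = refl
    ... | tri> _ _ gt = ⊥-elim (<-irrefl refl gt)

    beyond-> : ∀ {i j q} → toℕ j < toℕ i → beyond i (j , q) ≡ cdist j (toℕ q) (suc (t j)) + between (toℕ j) (toℕ i)
    beyond-> {i} {j} {q} gt with <-cmp (toℕ i) (toℕ j)
    ... | tri< lt _ _ = ⊥-elim (<⇒≱ lt (<⇒≤ gt))
    ... | tri≈ _ e _ = ⊥-elim (<⇒≢ gt (sym e))
    ... | tri> _ _ _ = refl

  exit<N : ∀ i y → exit i y < OddCycle.N (t i)
  exit<N i (j , q) with <-cmp (toℕ i) (toℕ j)
  ... | tri< lt _ _ rewrite exit-< {i} {j} {q} lt = 1+t<N i
  ... | tri≈ _ e _ with toℕ-injective e
  ... | refl rewrite exit-≡ {i} {q} = pos<N q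
  exit<N i (j , q) | tri> _ _ gt rewrite exit-> {i} {j} {q} gt = 0<N i

  exit-≡′ : ∀ {i j q} → i ≡ j → exit i (j , q) ≡ toℕ q
  exit-≡′ refl = exit-≡

  distVia : Fin m → ℕ → D → ℕ
  distVia i p y = cdist i p (exit i y) + beyond i y

  chainDist : D → D → ℕ
  chainDist (i , p) = distVia i (toℕ p)

  distVia-< : ∀ {i j} p q → toℕ i < toℕ j →
    distVia i p (j , q) ≡ cdist i p (suc (t i)) + (between (toℕ i) (toℕ j) + cdist j 0 (toℕ q))
  distVia-< {i} p q lt = cong₂ _+_ (cong (cdist i p) (exit-< lt)) (beyond-< lt)

  distVia-≡ : ∀ {i} p q → distVia i p (i , q) ≡ cdist i p (toℕ q) + 0
  distVia-≡ {i} p q = cong₂ _+_ (cong (cdist i p) exit-≡) beyond-≡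

  distVia-> : ∀ {i j} p q → toℕ j < toℕ i →
    distVia i p (j , q) ≡ cdist i p 0 + (cdist j (toℕ q) (suc (t j)) + between (toℕ j) (toℕ i))
  distVia-> {i} p q gt = cong₂ _+_ (cong (cdist i p) (exit-> gt)) (beyond-> gt)

  chainDist-step≤ : ∀ {a b} y → CycAdj a b → chainDist a y ≤ suc (chainDist b y)
  chainDist-step≤ {i , p} {.i , q} y (refl , r) =
    +-monoˡ-≤ (beyond i y) (OddCycle.dist-neighbour≤ (t i) (pos<N p) (exit<N i y)
      (cycleStep⇒neighbour (pos<N q) (subst (λ z → CycleStep z (toℕ p) (toℕ q)) (n≡2t+1 i) r)))

  chainDist-refl : ∀ x → chainDist x x ≡ 0
  chainDist-refl (i , p) = trans (distVia-≡ (toℕ p) p) (trans (+-identityʳ _) (OddCycle.dist-refl (t i) (toℕ p)))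

  chainDist-sym-< : ∀ {i j} (p : Fin (n i)) (q : Fin (n j)) → toℕ i < toℕ j →
    chainDist (i , p) (j , q) ≡ chainDist (j , q) (i , p)
  chainDist-sym-< {i} {j} p q lt = begin
    distVia i (toℕ p) (j , q)                                      ≡⟨ distVia-< (toℕ p) q lt ⟩
    P + (B + cdist j 0 (toℕ q))                                    ≡⟨ x∙yz≈z∙xy P B (cdist j 0 (toℕ q)) ⟩
    cdist j 0 (toℕ q) + (P + B)                                    ≡⟨ cong (_+ (P + B)) (OddCycle.dist-sym (t j) (0<N j) (pos<N q)) ⟩
    cdist j (toℕ q) 0 + (P + B)                                    ≡⟨ distVia-> (toℕ q) p lt ⟨
    distVia j (toℕ q) (i , p)                                      ∎
    where
    open ≡-Reasoning
    P = cdist i (toℕ p) (suc (t i))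
    B = between (toℕ i) (toℕ j)

  chainDist-sym : ∀ x y → chainDist x y ≡ chainDist y x
  chainDist-sym (i , p) (j , q) with <-cmp (toℕ i) (toℕ j)
  ... | tri< lt _ _ = chainDist-sym-< p q lt
  ... | tri> _ _ gt = sym (chainDist-sym-< q p gt)
  ... | tri≈ _ e _ with toℕ-injective e
  ... | refl = trans (distVia-≡ (toℕ p) q)
                 (trans (cong (_+ 0) (OddCycle.dist-sym (t i) (pos<N p) (pos<N q))) (sym (distVia-≡ (toℕ q) p)))

  half-n : ∀ i → (n i + 1) / 2 ≡ suc (t i)
  half-n i rewrite n≡2t+1 i = [2t+1+1]/2≡1+t (t i)

  glued? : (x : D) → Dec (Glued x)
  glued? x = (0 <? toℕ (proj₁ x)) ×-dec (toℕ (proj₂ x) ≟ 0)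

  cutPos : ∀ j → Fin (n j)
  cutPos j = fromℕ< (subst (suc (t j) <_) (sym (n≡2t+1 j)) (1+t<N j))

  predCycle : Fin m → Fin m
  predCycle i = fromℕ< (≤-<-trans (pred[n]≤n {toℕ i}) (toℕ<n i))

  toℕ-predCycle : ∀ i → toℕ (predCycle i) ≡ pred (toℕ i)
  toℕ-predCycle i = toℕ-fromℕ< _

  canonical : D → D
  canonical x with glued? x
  ... | yes _ = predCycle (proj₁ x) , cutPos (predCycle (proj₁ x))
  ... | no _ = x

  toℕ-cutPos : ∀ j → toℕ (cutPos j) ≡ suc (t j)
  toℕ-cutPos j = toℕ-fromℕ< _

  Rep-canonical : ∀ x → Rep x (canonical x)
  Rep-canonical x with glued? x
  ... | no g = self g
  ... | yes (lt , e) = glue (trans (sym (suc-pred (toℕ (proj₁ x)) {{>-nonZero lt}})) (cong suc (sym (toℕ-predCycle (proj₁ x)))))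
                           e (trans (toℕ-cutPos _) (sym (half-n _)))

  IsV-canonical : ∀ x → IsV (canonical x)
  IsV-canonical x with glued? x
  ... | no g = g
  ... | yes _ = λ { (_ , e) → 1+n≢0 (trans (sym (toℕ-cutPos _)) e) }

  Rep→IsV : ∀ {b w} → Rep b w → IsV w
  Rep→IsV (self g) = g
  Rep→IsV {b} {w} (glue _ _ e) (_ , e0) = 1+n≢0 (trans (sym (trans e (half-n (proj₁ w)))) e0)

  cdist-cut-0 : ∀ i → cdist i (suc (t i)) 0 ≡ t i
  cdist-cut-0 i = OddCycle.dist-antipodal (t i) z≤n (inj₂ refl)

  cdist-0-cut : ∀ i → cdist i 0 (suc (t i)) ≡ t i
  cdist-0-cut i = trans (OddCycle.dist-sym (t i) (0<N i) (1+t<N i)) (cdist-cut-0 i)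

  -- The glued vertex seen as the entry (i′ , 0) of cycle i′ and as the exit (i , t i + 1) of its predecessor i.
  module _ {i′ i : Fin m} (i′≡1+i : toℕ i′ ≡ suc (toℕ i)) where

    i<i′ : toℕ i < toℕ i′
    i<i′ = ≤-reflexive (sym i′≡1+i)

    glued-later : ∀ {j} q → toℕ i′ < toℕ j → distVia i′ 0 (j , q) ≡ distVia i (suc (t i)) (j , q)
    glued-later {j} q lt = begin
      distVia i′ 0 (j , q)
        ≡⟨ distVia-< 0 q lt ⟩
      cdist i′ 0 (suc (t i′)) + (between (toℕ i′) (toℕ j) + C)
        ≡⟨ cong (_+ (between (toℕ i′) (toℕ j) + C)) (cdist-0-cut i′) ⟩
      t i′ + (between (toℕ i′) (toℕ j) + C)
        ≡⟨ +-assoc (t i′) _ C ⟨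
      t i′ + between (toℕ i′) (toℕ j) + C
        ≡⟨ cong (_+ C) gap-split ⟨
      between (toℕ i) (toℕ j) + C
        ≡⟨ cong (_+ (between (toℕ i) (toℕ j) + C)) (OddCycle.dist-refl (t i) (suc (t i))) ⟨
      cdist i (suc (t i)) (suc (t i)) + (between (toℕ i) (toℕ j) + C)
        ≡⟨ distVia-< (suc (t i)) q (<-trans i<i′ lt) ⟨
      distVia i (suc (t i)) (j , q) ∎
      where
      open ≡-Reasoning
      C = cdist j 0 (toℕ q)
      gap-split : between (toℕ i) (toℕ j) ≡ t i′ + between (toℕ i′) (toℕ j)
      gap-split = trans (between-stepˡ (subst (_< toℕ j) i′≡1+i lt))
        (cong₂ _+_ (trans (cong t′ (sym i′≡1+i)) (t′-toℕ i′)) (cong (λ z → between z (toℕ j)) (sym i′≡1+i)))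

    glued-entry : ∀ q → distVia i′ 0 (i′ , q) ≡ distVia i (suc (t i)) (i′ , q)
    glued-entry q = begin
      distVia i′ 0 (i′ , q)
        ≡⟨ distVia-≡ 0 q ⟩
      cdist i′ 0 (toℕ q) + 0
        ≡⟨ +-comm _ 0 ⟩
      0 + cdist i′ 0 (toℕ q)
        ≡⟨ cong₂ _+_ (OddCycle.dist-refl (t i) (suc (t i))) (cong (_+ cdist i′ 0 (toℕ q)) nothing-between) ⟨
      cdist i (suc (t i)) (suc (t i)) + (between (toℕ i) (toℕ i′) + cdist i′ 0 (toℕ q))
        ≡⟨ distVia-< (suc (t i)) q i<i′ ⟨
      distVia i (suc (t i)) (i′ , q) ∎
      where
      open ≡-Reasoning
      nothing-between : between (toℕ i) (toℕ i′) ≡ 0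
      nothing-between = trans (cong (between (toℕ i)) i′≡1+i) (between-adjacent (toℕ i))

    glued-exit : ∀ q → distVia i′ 0 (i , q) ≡ distVia i (suc (t i)) (i , q)
    glued-exit q = begin
      distVia i′ 0 (i , q)
        ≡⟨ distVia-> 0 q i<i′ ⟩
      cdist i′ 0 0 + (cdist i (toℕ q) (suc (t i)) + between (toℕ i) (toℕ i′))
        ≡⟨ cong₂ (λ a b → a + (cdist i (toℕ q) (suc (t i)) + b)) (OddCycle.dist-refl (t i′) 0)
                 (trans (cong (between (toℕ i)) i′≡1+i) (between-adjacent (toℕ i))) ⟩
      cdist i (toℕ q) (suc (t i)) + 0
        ≡⟨ cong (_+ 0) (OddCycle.dist-sym (t i) (pos<N q) (1+t<N i)) ⟩
      cdist i (suc (t i)) (toℕ q) + 0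
        ≡⟨ distVia-≡ (suc (t i)) q ⟨
      distVia i (suc (t i)) (i , q) ∎
      where open ≡-Reasoning

    glued-earlier : ∀ {j} q → toℕ j < toℕ i → distVia i′ 0 (j , q) ≡ distVia i (suc (t i)) (j , q)
    glued-earlier {j} q lt = begin
      distVia i′ 0 (j , q)
        ≡⟨ distVia-> 0 q (<-trans lt i<i′) ⟩
      cdist i′ 0 0 + (E + between (toℕ j) (toℕ i′))
        ≡⟨ cong₂ (λ a b → a + (E + b)) (OddCycle.dist-refl (t i′) 0) gap-split ⟩
      E + (between (toℕ j) (toℕ i) + t i)
        ≡⟨ x∙yz≈z∙xy E (between (toℕ j) (toℕ i)) (t i) ⟩
      t i + (E + between (toℕ j) (toℕ i))
        ≡⟨ cong (_+ (E + between (toℕ j) (toℕ i))) (cdist-cut-0 i) ⟨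
      cdist i (suc (t i)) 0 + (E + between (toℕ j) (toℕ i))
        ≡⟨ distVia-> (suc (t i)) q lt ⟨
      distVia i (suc (t i)) (j , q) ∎
      where
      open ≡-Reasoning
      E = cdist j (toℕ q) (suc (t j))
      gap-split : between (toℕ j) (toℕ i′) ≡ between (toℕ j) (toℕ i) + t i
      gap-split = trans (cong (between (toℕ j)) i′≡1+i)
        (trans (between-stepʳ lt) (cong (between (toℕ j) (toℕ i) +_) (t′-toℕ i)))

    glued-distVia : ∀ y → distVia i′ 0 y ≡ distVia i (suc (t i)) y
    glued-distVia (j , q) with <-cmp (toℕ i′) (toℕ j) | <-cmp (toℕ j) (toℕ i)
    ... | tri< lt _ _ | _ = glued-later q lt
    ... | tri≈ _ e _ | _ with toℕ-injective e
    ...   | refl = glued-entry q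
    glued-distVia (j , q) | tri> _ _ _ | tri< lt _ _ = glued-earlier q lt
    glued-distVia (j , q) | tri> _ _ _ | tri≈ _ e _ with toℕ-injective e
    ... | refl = glued-exit q
    glued-distVia (j , q) | tri> _ _ gt | tri> _ _ j>i = ⊥-elim (<⇒≱ (subst (toℕ j <_) i′≡1+i gt) j>i)

  chainDist-Rep : ∀ {a x} → Rep a x → ∀ y → chainDist a y ≡ chainDist x y
  chainDist-Rep (self _) y = refl
  chainDist-Rep {i′ , _} {i , _} (glue c e0 ex) y rewrite e0 | trans ex (half-n i) = glued-distVia c y

  chainDist≡0⇒≡ : ∀ {x y} → IsV x → IsV y → chainDist x y ≡ 0 → x ≡ y
  chainDist≡0⇒≡ {i , p} {j , q} gx gy e with <-cmp (toℕ i) (toℕ j)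
  ... | tri< lt _ _ = ⊥-elim (gy (≤-trans z<s lt , sym (OddCycle.dist≡0⇒≡ (t j) (0<N j) (pos<N q)
        (m+n≡0⇒n≡0 (between (toℕ i) (toℕ j)) (m+n≡0⇒n≡0 (cdist i (toℕ p) (suc (t i))) (trans (sym (distVia-< (toℕ p) q lt)) e))))))
  ... | tri> _ _ gt = ⊥-elim (gx (≤-trans z<s gt ,
        OddCycle.dist≡0⇒≡ (t i) (pos<N p) (0<N i) (m+n≡0⇒m≡0 _ (trans (sym (distVia-> (toℕ p) q gt)) e))))
  ... | tri≈ _ e′ _ with toℕ-injective e′
  ... | refl = cong (i ,_) (toℕ-injective
        (OddCycle.dist≡0⇒≡ (t i) (pos<N p) (pos<N q) (m+n≡0⇒m≡0 _ (trans (sym (distVia-≡ (toℕ p) q)) e))))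

  chainDist≤walk : ∀ {x y k} → Walk x y k → chainDist x y ≤ k
  chainDist≤walk {x} here = ≤-reflexive (chainDist-refl x)
  chainDist≤walk {x} {y} (step {y = x′} {k = k} (a , b , ab , ra , rb) w) = begin
    chainDist x y         ≡⟨ chainDist-Rep ra y ⟨
    chainDist a y         ≤⟨ chainDist-step≤ y ab ⟩
    suc (chainDist b y)   ≡⟨ cong suc (chainDist-Rep rb y) ⟩
    suc (chainDist x′ y)  ≤⟨ s≤s (chainDist≤walk w) ⟩
    suc k                 ∎
    where open ≤-Reasoning

  neighbourVertex : ∀ {x} a → Rep a x → ∀ p' → Neighbour (OddCycle.N (t (proj₁ a))) (toℕ (proj₂ a)) p' →
         Σ D λ w → Adj x w × IsV w × (∀ y → chainDist w y ≡ cdist (proj₁ a) p' (exit (proj₁ a) y) + beyond (proj₁ a) y)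
  neighbourVertex {x} (i , pa) ra p' nb = canonical b , (((i , pa) , b , (refl , rel) , ra , Rep-canonical b)) , IsV-canonical b , fe
    where
    p'<N : p' < OddCycle.N (t i)
    p'<N = OddCycle.Neighbour<N (t i) (pos<N pa) nb
    p'<n : p' < n i
    p'<n = subst (p' <_) (sym (n≡2t+1 i)) p'<N
    b : D
    b = i , fromℕ< p'<n
    rel : CycleStep (n i) (toℕ pa) (toℕ (fromℕ< p'<n))
    rel rewrite toℕ-fromℕ< p'<n = subst (λ z → CycleStep z (toℕ pa) p') (sym (n≡2t+1 i)) (neighbour⇒cycleStep (pos<N pa) nb)
    fe : ∀ y → chainDist (canonical b) y ≡ cdist i p' (exit i y) + beyond i y
    fe y = trans (sym (chainDist-Rep (Rep-canonical b) y)) (cong (λ z → cdist i z (exit i y) + beyond i y) (toℕ-fromℕ< p'<n))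

  nextCycleRep : ∀ {i p} → suc (toℕ i) < m → toℕ p ≡ suc (t i) →
    Σ D λ a → Rep a (i , p) × toℕ (proj₁ a) ≡ suc (toℕ i) × toℕ (proj₂ a) ≡ 0
  nextCycleRep {i} sl ex =
    (i′ , zero′) , glue (toℕ-fromℕ< _) (toℕ-fromℕ< _) (trans ex (sym (half-n i))) , toℕ-fromℕ< _ , toℕ-fromℕ< _
    where
    i′ : Fin m
    i′ = fromℕ< sl
    zero′ : Fin (n i′)
    zero′ = fromℕ< (subst (0 <_) (sym (n≡2t+1 i′)) (0<N i′))

  representative-off-exit : ∀ {x y} → IsV x → IsV y → x ≢ y →
    Σ D λ a → Rep a x × toℕ (proj₂ a) ≢ exit (proj₁ a) y
  representative-off-exit {i , p} {j , q} gx gy x≢y with <-cmp (toℕ i) (toℕ j)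
  ... | tri≈ _ e _ with toℕ-injective e
  ... | refl = (i , p) , self gx , λ e′ → x≢y (cong (i ,_) (toℕ-injective (trans e′ exit-≡)))
  representative-off-exit {i , p} {j , q} gx gy x≢y | tri> _ _ gt =
    (i , p) , self gx , λ e → gx (≤-trans z<s gt , trans e (exit-> gt))
  representative-off-exit {i , p} {j , q} gx gy x≢y | tri< lt _ _ with toℕ p ≟ suc (t i)
  ... | no ¬cut = (i , p) , self gx , λ e → ¬cut (trans e (exit-< lt))
  ... | yes cut with nextCycleRep (≤-<-trans lt (toℕ<n j)) cut
  ... | (i′ , z) , rep , i′≡1+i , z≡0 = (i′ , z) , rep , off-exit
    where
    off-exit : toℕ z ≢ exit i′ (j , q)
    off-exit e with <-cmp (toℕ i′) (toℕ j)
    ... | tri< l _ _ = 1+n≢0 (trans (sym (exit-< l)) (trans (sym e) z≡0))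
    ... | tri≈ _ e₂ _ = gy (≤-trans z<s lt , trans (sym (exit-≡′ (toℕ-injective e₂))) (trans (sym e) z≡0))
    ... | tri> _ _ g = <⇒≱ g (subst (_≤ toℕ j) (sym i′≡1+i) lt)

  chainDist-descent : ∀ {x y} → IsV x → IsV y → x ≢ y →
    Σ D λ w → Adj x w × IsV w × suc (chainDist w y) ≡ chainDist x y
  chainDist-descent {x} {y} gx gy ne with representative-off-exit gx gy ne
  ... | (i , pa) , ra , nt' with OddCycle.dist-descent (t i) (pos<N pa) (exit<N i y) nt'
  ... | p' , nb , e with neighbourVertex (i , pa) ra p' nb
  ... | w , adj , gw , fe = w , adj , gw , trans (cong suc (fe y)) (trans (cong (_+ beyond i y) e) (chainDist-Rep ra y))

  chainDist≡suc⇒≢ : ∀ {x y k} → chainDist x y ≡ suc k → x ≢ y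
  chainDist≡suc⇒≢ {x} e refl = 1+n≢0 (trans (sym e) (chainDist-refl x))

  walk-of-chainDist : ∀ k x y → IsV x → IsV y → chainDist x y ≡ k → Walk x y k
  walk-of-chainDist zero x y gx gy e = subst (λ z → Walk x z 0) (chainDist≡0⇒≡ gx gy e) here
  walk-of-chainDist (suc k) x y gx gy e = go (chainDist-descent gx gy (chainDist≡suc⇒≢ e))
    where
    go : (Σ D λ w → Adj x w × IsV w × suc (chainDist w y) ≡ chainDist x y) → Walk x y (suc k)
    go (w , adj , gw , e') = step adj (walk-of-chainDist k w y gw gy (suc-injective (trans e' e)))

  Dist-chainDist : ∀ {x y} → IsV x → IsV y → Dist x y (chainDist x y)
  Dist-chainDist {x} {y} gx gy = walk-of-chainDist _ x y gx gy refl , λ k' w → chainDist≤walk w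

  Dist⇒≡chainDist : ∀ {x y k} → IsV x → IsV y → Dist x y k → k ≡ chainDist x y
  Dist⇒≡chainDist {x} {y} gx gy (w , mn) = ≤-antisym (mn _ (walk-of-chainDist _ x y gx gy refl)) (chainDist≤walk w)

  NonCut : D → Set
  NonCut u = toℕ (proj₂ u) ≢ suc (t (proj₁ u)) ⊎ suc (toℕ (proj₁ u)) ≡ m

  Rep-nonCut : ∀ {u} → NonCut u → ∀ {a} → Rep a u → a ≡ u
  Rep-nonCut _ (self _) = refl
  Rep-nonCut {u} (inj₁ ne) (glue c e0 ex) = ⊥-elim (ne (trans ex (half-n (proj₁ u))))
  Rep-nonCut {u} (inj₂ e) {a} (glue c e0 ex) = ⊥-elim (<-irrefl (trans c e) (toℕ<n (proj₁ a)))

  antipodal⇒MaxDist : ∀ {u v} → IsV u → IsV v → NonCut u →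
             cdist (proj₁ u) (toℕ (proj₂ u)) (exit (proj₁ u) v) ≡ t (proj₁ u) → MaxDist u v
  antipodal⇒MaxDist {u} {v} gu gv nc e w (a′ , b′ , ca , ra , rb) da db dv du with Rep-nonCut nc ra
  ... | refl = go ca
    where
    gw = Rep→IsV rb
    go : CycAdj u b′ → da ≤ db
    go (refl , _) = begin
      da                                                               ≡⟨ Dist⇒≡chainDist gv gw dv ⟩
      chainDist v w                                                    ≡⟨ chainDist-sym v w ⟩
      chainDist w v                                                    ≡⟨ chainDist-Rep rb v ⟨
      cdist (proj₁ u) (toℕ (proj₂ b′)) (exit (proj₁ u) v) + beyond (proj₁ u) v
                                                                       ≤⟨ +-monoˡ-≤ _ (OddCycle.dist≤t (t (proj₁ u)) _ _) ⟩
      t (proj₁ u) + beyond (proj₁ u) v                                 ≡⟨ cong (_+ beyond (proj₁ u) v) e ⟨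
      chainDist u v                                                    ≡⟨ Dist⇒≡chainDist gu gv du ⟨
      db                                                               ∎
      where open ≤-Reasoning

  ¬antipodal⇒¬MaxDist : ∀ {u v a} → IsV u → IsV v → Rep a u →
             cdist (proj₁ a) (toℕ (proj₂ a)) (exit (proj₁ a) v) < t (proj₁ a) → ¬ MaxDist u v
  ¬antipodal⇒¬MaxDist {u} {v} {i , pa} gu gv ra lt md with OddCycle.dist-ascent (t i) (t≥1 i) (pos<N pa) (exit<N i v) lt
  ... | p' , nb , e with neighbourVertex (i , pa) ra p' nb
  ... | w , adj , gw , fe =
    <-irrefl refl (≤-trans (≤-reflexive (sym eq)) (md w adj _ _ (Dist-chainDist gv gw) (Dist-chainDist gu gv)))
    where
    eq : chainDist v w ≡ suc (chainDist u v)
    eq = trans (chainDist-sym v w) (trans (fe v) (trans (cong (_+ beyond i v) e) (cong suc (chainDist-Rep ra v))))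

-- A vertex cover of size formula

module UpperBound (m : ℕ) (n : Fin m → ℕ) (t : Fin m → ℕ)
         (n≡2t+1 : ∀ i → n i ≡ suc (t i + t i)) (t≥1 : ∀ i → 1 ≤ t i) where
  open Chain m n
  open Geometry m n t n≡2t+1 t≥1

  isLast : Fin m → Bool
  isLast i = suc (toℕ i) ≡ᵇ m

  isLast-false⇒< : ∀ {i} → isLast i ≡ false → suc (toℕ i) < m
  isLast-false⇒< {i} e = ≤∧≢⇒< (toℕ<n i) (λ e' → subst T e (≡⇒≡ᵇ _ _ e'))

  inCover : Fin m → ℕ → Bool
  inCover i zero = false
  inCover i (suc k) = (k <ᵇ t i) ∨ (isLast i ∧ (k ≡ᵇ t i))

  InCover : D → Set
  InCover (i , p) = T (inCover i (toℕ p))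

  outsideCover : ∀ i k → ¬ T (inCover i k) → (k ≡ suc (t i) × isLast i ≡ false) ⊎ OddCycle.UpperArc (t i) k
  outsideCover i zero _ = inj₂ (inj₁ refl)
  outsideCover i (suc k) nin with k <ᵇ t i in e1
  ... | true = ⊥-elim (nin tt)
  ... | false with k ≟ t i
  ...   | no ne = inj₂ (inj₂ (s≤s (≤∧≢⇒< (≮⇒≥ (λ lt → subst T e1 (<⇒<ᵇ lt))) (λ x → ne (sym x)))))
  ...   | yes refl with isLast i in e2
  ...     | false = inj₁ (refl , refl)
  ...     | true = ⊥-elim (nin (≡⇒≡ᵇ k k refl))

  cut⇒¬MaxDist-forward : ∀ {i p v} → IsV (i , p) → IsV v → toℕ p ≡ suc (t i) → toℕ i < toℕ (proj₁ v) →
    ¬ MaxDist (i , p) v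
  cut⇒¬MaxDist-forward {i} {p} {j , q} gu gv ex lt = ¬antipodal⇒¬MaxDist gu gv (self gu)
    (subst (_< t i) (sym (trans (cong₂ (cdist i) ex (exit-< lt)) (OddCycle.dist-refl (t i) _))) (t≥1 i))

  -- Towards earlier cycles the cut vertex is the entry 0 of the next cycle, i.e. its own exit.
  cut⇒¬MaxDist-backward : ∀ {i p v} → IsV (i , p) → IsV v → toℕ p ≡ suc (t i) → suc (toℕ i) < m →
    toℕ (proj₁ v) ≤ toℕ i → ¬ MaxDist (i , p) v
  cut⇒¬MaxDist-backward {i} {p} {j , q} gu gv ex sl j≤i with nextCycleRep sl ex
  ... | (a , pa) , ra , a≡1+i , pa≡0 = ¬antipodal⇒¬MaxDist gu gv ra
    (subst (_< t a) (sym (trans (cong₂ (cdist a) pa≡0 (exit-> (subst (toℕ j <_) (sym a≡1+i) (s≤s j≤i))))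
                                (OddCycle.dist-refl (t a) 0)))
                    (t≥1 a))

  cut⇒¬MaxDist : ∀ {u v} → IsV u → IsV v → toℕ (proj₂ u) ≡ suc (t (proj₁ u)) → suc (toℕ (proj₁ u)) < m →
    ¬ MaxDist u v
  cut⇒¬MaxDist {i , p} {j , q} gu gv ex sl with toℕ i <? toℕ j
  ... | yes lt = cut⇒¬MaxDist-forward gu gv ex lt
  ... | no ¬lt = cut⇒¬MaxDist-backward gu gv ex sl (≮⇒≥ ¬lt)

  UpperArc-later⇒¬MaxDist : ∀ {i j p q} → toℕ i < toℕ j → IsV (i , p) → IsV (j , q) →
    OddCycle.UpperArc (t j) (toℕ q) → ¬ MaxDist (j , q) (i , p)
  UpperArc-later⇒¬MaxDist lt gu gv (inj₁ q≡0) = ⊥-elim (gv (≤-trans z<s lt , q≡0))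
  UpperArc-later⇒¬MaxDist {j = j} {q = q} lt gu gv (inj₂ far) = ¬antipodal⇒¬MaxDist gv gu (self gv)
    (subst (_< t j) (sym (cong (cdist j (toℕ q)) (exit-> lt))) (OddCycle.dist-from-0<t (t j) (pos<N q) far))

  UpperArc⇒¬MMD : ∀ {i j p q} → IsV (i , p) → IsV (j , q) → (i , p) ≢ (j , q) →
    OddCycle.UpperArc (t i) (toℕ p) → OddCycle.UpperArc (t j) (toℕ q) → ¬ MMD (i , p) (j , q)
  UpperArc⇒¬MMD {i} {j} {p} {q} gu gv u≢v arc-p arc-q (mu , mv) with <-cmp (toℕ i) (toℕ j)
  ... | tri< lt _ _ = UpperArc-later⇒¬MaxDist lt gu gv arc-q mv
  ... | tri> _ _ gt = UpperArc-later⇒¬MaxDist gt gv gu arc-p mu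
  ... | tri≈ _ e _ with toℕ-injective e
  ... | refl = ¬antipodal⇒¬MaxDist gu gv (self gu)
    (subst (_< t i) (sym (cong (cdist i (toℕ p)) exit-≡))
      (OddCycle.dist<t-UpperArc (t i) (pos<N p) (pos<N q) (λ e′ → u≢v (cong (i ,_) (toℕ-injective e′))) arc-p arc-q)) mu

  SREdge-meets-cover : ∀ {u v} → SREdge u v → ¬ InCover u → ¬ InCover v → ⊥
  SREdge-meets-cover {i , p} {j , q} (gu , gv , u≢v , mu , mv) nu nv
    with outsideCover i (toℕ p) nu | outsideCover j (toℕ q) nv
  ... | inj₁ (cut , notLast) | _ = cut⇒¬MaxDist gu gv cut (isLast-false⇒< notLast) mu
  ... | inj₂ _ | inj₁ (cut , notLast) = cut⇒¬MaxDist gv gu cut (isLast-false⇒< notLast) mv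
  ... | inj₂ arc-p | inj₂ arc-q = UpperArc⇒¬MMD gu gv u≢v arc-p arc-q (mu , mv)

  block : ∀ i → Fin (n i) → List D
  block i p = if inCover i (toℕ p) then [ (i , p) ] else []

  coverList : List D
  coverList = concat (tabulate λ i → concat (tabulate (block i)))

  ∈-block : ∀ i p → T (inCover i (toℕ p)) → (i , p) ∈ block i p
  ∈-block i p h with inCover i (toℕ p)
  ... | true = here refl
  ... | false = ⊥-elim h

  InCover⇒∈coverList : ∀ x → InCover x → x ∈ coverList
  InCover⇒∈coverList (i , p) h = ∈-concat-tabulate _ i (∈-concat-tabulate (block i) p (∈-block i p h))

  length-block : ∀ i p → length (block i p) ≡ bit (inCover i (toℕ p))
  length-block i p with inCover i (toℕ p)
  ... | true = refl
  ... | false = refl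

  ltb-eqb : ∀ k s → T (k <ᵇ s) → (k ≡ᵇ s) ≡ false
  ltb-eqb zero (suc s) _ = refl
  ltb-eqb (suc k) (suc s) h = ltb-eqb k s h

  bit-inCover-split : ∀ (last : Bool) k s →
    bit ((k <ᵇ s) ∨ (last ∧ (k ≡ᵇ s))) ≡ bit (k <ᵇ s) + (if last then bit (k ≡ᵇ s) else 0)
  bit-inCover-split last k s with k <ᵇ s in e
  ... | true rewrite ltb-eqb k s (subst T (sym e) tt) with last
  ...   | true = refl
  ...   | false = refl
  bit-inCover-split true k s | false = refl
  bit-inCover-split false k s | false = refl

  count-last : ∀ (last : Bool) s → 1 ≤ s →
    sumBelow (s + s) (λ k → if last then bit (k ≡ᵇ s) else 0) ≡ (if last then 1 else 0)
  count-last true s s1 = sumBelow-count-≡ (s + s) s (≤-trans (+-monoˡ-≤ s s1) ≤-refl)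
  count-last false s _ = sumBelow-zero (s + s)

  count-cycle : ∀ i → sumBelow (n i) (λ k → bit (inCover i k)) ≡ t i + bit (isLast i)
  count-cycle i rewrite n≡2t+1 i =
    trans (sumBelow-cong (t i + t i) (λ k _ → bit-inCover-split (isLast i) k (t i)))
     (trans (sumBelow-distrib-+ (t i + t i) _ _)
      (cong₂ _+_ (sumBelow-count-< (t i + t i) (t i) (m≤m+n (t i) (t i))) (trans (count-last (isLast i) (t i) (t≥1 i)) (lb (isLast i)))))
    where
    lb : ∀ last → (if last then 1 else 0) ≡ bit last
    lb true = refl
    lb false = refl

  length-coverList : length coverList ≡ ∑[ i < m ] (t i + bit (isLast i))
  length-coverList = trans (length-concat-tabulate m _) (sum-cong-≗ λ i →
    trans (length-concat-tabulate (n i) (block i))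
    (trans (sum-cong-≗ (length-block i)) (trans (∑-toℕ (n i) (λ k → bit (inCover i k))) (count-cycle i))))

  notFirst : Fin m → ℕ
  notFirst i = if toℕ i ≡ᵇ 0 then 0 else 1

  term : Fin m → ℕ
  term i = if (toℕ i ≡ᵇ 0) ∨ (suc (toℕ i) ≡ᵇ m) then n i / 2 else (n i ∸ 2) / 2

  n/2≡t : ∀ i → n i / 2 ≡ t i
  n/2≡t i rewrite n≡2t+1 i = [2t+1]/2≡t (t i)

  term+notFirst : 2 ≤ m → ∀ i → term i + notFirst i ≡ t i + bit (isLast i)
  term+notFirst m≥2 i with toℕ i ≡ᵇ 0 in e₀ | suc (toℕ i) ≡ᵇ m in eₗ
  ... | true  | true  = ⊥-elim (<-irrefl (trans (cong suc (sym (≡ᵇ-true⇒≡ e₀))) (≡ᵇ-true⇒≡ eₗ)) m≥2)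
  ... | true  | false = trans (+-identityʳ _) (trans (n/2≡t i) (sym (+-identityʳ _)))
  ... | false | true  = cong (_+ 1) (n/2≡t i)
  ... | false | false rewrite n≡2t+1 i = begin
    (suc (t i + t i) ∸ 2) / 2 + 1    ≡⟨ cong (_+ 1) ([2t+1∸2]/2≡t∸1 (t i) (t≥1 i)) ⟩
    t i ∸ 1 + 1                      ≡⟨ m∸n+n≡m (t≥1 i) ⟩
    t i                              ≡⟨ +-identityʳ (t i) ⟨
    t i + 0                          ∎
    where open ≡-Reasoning

  term-kind : 2 ≤ m → ∀ i →
    (toℕ i ≡ 0 × term i ≡ t i) ⊎ (suc (toℕ i) ≡ m × term i ≡ t i) ⊎ term i ≡ t i ∸ 1
  term-kind m≥2 i with toℕ i ≡ᵇ 0 in e₀ | suc (toℕ i) ≡ᵇ m in eₗ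
  ... | true  | true  = ⊥-elim (<-irrefl (trans (cong suc (sym (≡ᵇ-true⇒≡ e₀))) (≡ᵇ-true⇒≡ eₗ)) m≥2)
  ... | true  | false = inj₁ (≡ᵇ-true⇒≡ e₀ , n/2≡t i)
  ... | false | true  = inj₂ (inj₁ (≡ᵇ-true⇒≡ eₗ , n/2≡t i))
  ... | false | false = inj₂ (inj₂ (trans (cong (λ k → (k ∸ 2) / 2) (n≡2t+1 i)) ([2t+1∸2]/2≡t∸1 (t i) (t≥1 i))))

  formula≡∑term : formula ≡ ∑[ i < m ] term i + (m ∸ 1)
  formula≡∑term = trans (+-comm (m ∸ 1) _) (cong (_+ (m ∸ 1)) (sum-tabulate m term))

  length-coverList≡formula : 2 ≤ m → length coverList ≡ formula
  length-coverList≡formula m≥2 = begin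
    length coverList                                ≡⟨ length-coverList ⟩
    ∑[ i < m ] (t i + bit (isLast i))               ≡⟨ sum-cong-≗ (term+notFirst m≥2) ⟨
    ∑[ i < m ] (term i + notFirst i)                ≡⟨ ∑-distrib-+ term notFirst ⟩
    ∑[ i < m ] term i + ∑[ i < m ] notFirst i       ≡⟨ cong (∑[ i < m ] term i +_) (∑-notFirst m) ⟩
    ∑[ i < m ] term i + (m ∸ 1)                     ≡⟨ formula≡∑term ⟨
    formula                                         ∎
    where open ≡-Reasoning

  coverList-isCover : VertexCover coverList
  coverList-isCover u v sr with T? (inCover (proj₁ u) (toℕ (proj₂ u))) | T? (inCover (proj₁ v) (toℕ (proj₂ v)))
  ... | yes hu | _ = inj₁ (InCover⇒∈coverList u hu)
  ... | no _ | yes hv = inj₂ (InCover⇒∈coverList v hv)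
  ... | no nu | no nv = ⊥-elim (SREdge-meets-cover sr nu nv)

-- Every vertex cover has size at least formula

module LowerBound (m : ℕ) (n : Fin m → ℕ) (t : Fin m → ℕ)
         (n≡2t+1 : ∀ i → n i ≡ suc (t i + t i)) (t≥1 : ∀ i → 1 ≤ t i) (t≥2 : ∀ i → 2 ≤ t i) where
  open Chain m n
  open Geometry m n t n≡2t+1 t≥1
  open UpperBound m n t n≡2t+1 t≥1 using (term; term-kind)

  -- Membership in C, read off by coordinates so that it can be counted cycle by cycle.
  isAt : D → Fin m → ℕ → Bool
  isAt x i k = (toℕ i ≡ᵇ toℕ (proj₁ x)) ∧ (k ≡ᵇ toℕ (proj₂ x))

  memberAt : List D → Fin m → ℕ → Bool
  memberAt [] i k = false
  memberAt (x ∷ C) i k = isAt x i k ∨ memberAt C i k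

  ∈⇒memberAt : ∀ {x C} → x ∈ C → T (memberAt C (proj₁ x) (toℕ (proj₂ x)))
  ∈⇒memberAt {i , p} (here refl) =
    Equivalence.from T-∨ (inj₁ (Equivalence.from T-∧ (≡⇒≡ᵇ (toℕ i) (toℕ i) refl , ≡⇒≡ᵇ (toℕ p) (toℕ p) refl)))
  ∈⇒memberAt (there x∈C) = Equivalence.from T-∨ (inj₂ (∈⇒memberAt x∈C))

  occupancy : List D → ℕ
  occupancy C = ∑[ i < m ] sumBelow (n i) (λ k → bit (memberAt C i k))

  occupancy-singleton≤1 : ∀ x → ∑[ i < m ] sumBelow (n i) (λ k → bit (isAt x i k)) ≤ 1
  occupancy-singleton≤1 (j , p) =
    ≤-trans (∑-mono-≤ m inner) (≤-trans (≤-reflexive (∑-toℕ m (λ c → bit (c ≡ᵇ toℕ j)))) (sumBelow-count-≡≤1 m (toℕ j)))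
    where
    inner : ∀ i → sumBelow (n i) (λ k → bit (isAt (j , p) i k)) ≤ bit (toℕ i ≡ᵇ toℕ j)
    inner i with toℕ i ≡ᵇ toℕ j
    ... | true = sumBelow-count-≡≤1 (n i) (toℕ p)
    ... | false = ≤-reflexive (sumBelow-zero (n i))

  occupancy≤length : ∀ C → occupancy C ≤ length C
  occupancy≤length [] = ≤-reflexive (trans (sum-cong-≗ (λ i → sumBelow-zero (n i))) (sum-replicate-zero m))
  occupancy≤length (x ∷ C) = begin
    occupancy (x ∷ C)
      ≤⟨ ∑-mono-≤ m (λ i → sumBelow-mono (n i) (λ k _ → bit-∨ (isAt x i k) (memberAt C i k))) ⟩
    ∑[ i < m ] sumBelow (n i) (λ k → bit (isAt x i k) + bit (memberAt C i k))
      ≡⟨ trans (sum-cong-≗ (λ i → sumBelow-distrib-+ (n i) _ _))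
               (∑-distrib-+ {m} (λ i → sumBelow (n i) (λ k → bit (isAt x i k))) (λ i → sumBelow (n i) (λ k → bit (memberAt C i k)))) ⟩
    ∑[ i < m ] sumBelow (n i) (λ k → bit (isAt x i k)) + occupancy C
      ≤⟨ +-mono-≤ (occupancy-singleton≤1 x) (occupancy≤length C) ⟩
    length (x ∷ C) ∎
    where open ≤-Reasoning

  NonCutPos : Fin m → ℕ → Set
  NonCutPos i a = a ≢ suc (t i) ⊎ suc (toℕ i) ≡ m

  antipodal⇒SREdge : ∀ {u v} → IsV u → IsV v → u ≢ v → NonCut u → NonCut v →
            cdist (proj₁ u) (toℕ (proj₂ u)) (exit (proj₁ u) v) ≡ t (proj₁ u) →
            cdist (proj₁ v) (toℕ (proj₂ v)) (exit (proj₁ v) u) ≡ t (proj₁ v) → SREdge u v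
  antipodal⇒SREdge gu gv ne ncu ncv e1 e2 = gu , gv , ne , antipodal⇒MaxDist gu gv ncu e1 , antipodal⇒MaxDist gv gu ncv e2

  vertexAt : ∀ i {a} → a < OddCycle.N (t i) → D
  vertexAt i {a} lt = i , fromℕ< (subst (a <_) (sym (n≡2t+1 i)) lt)

  pos-vertexAt : ∀ i {a} (lt : a < OddCycle.N (t i)) → toℕ (proj₂ (vertexAt i lt)) ≡ a
  pos-vertexAt i lt = toℕ-fromℕ< _

  IsV-vertexAt : ∀ i {a} (lt : a < OddCycle.N (t i)) → (a ≢ 0 ⊎ toℕ i ≡ 0) → IsV (vertexAt i lt)
  IsV-vertexAt i lt (inj₁ ne) (_ , e) = ne (trans (sym (pos-vertexAt i lt)) e)
  IsV-vertexAt i lt (inj₂ e0) (l , _) = <-irrefl (sym e0) l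

  NonCut-vertexAt : ∀ i {a} (lt : a < OddCycle.N (t i)) → NonCutPos i a → NonCut (vertexAt i lt)
  NonCut-vertexAt i lt (inj₁ ne) = inj₁ (λ e → ne (trans (sym (pos-vertexAt i lt)) e))
  NonCut-vertexAt i lt (inj₂ e) = inj₂ e

  1+b<N : ∀ i {b} → b < t i → suc b < OddCycle.N (t i)
  1+b<N i lt = s≤s (≤-trans lt (m≤m+n (t i) (t i)))

  1+t+b<N : ∀ i {b} → b < t i → suc (t i + b) < OddCycle.N (t i)
  1+t+b<N i {b} lt = s≤s (≤-trans (≤-reflexive (sym (+-suc (t i) b))) (+-monoʳ-≤ (t i) lt))

  2+t+b<N : ∀ i {b} → suc b < t i → suc (suc (t i + b)) < OddCycle.N (t i)
  2+t+b<N i {b} lt = subst (_< OddCycle.N (t i)) (cong suc (+-suc (t i) b)) (1+t+b<N i lt)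

  t<N : ∀ i → t i < OddCycle.N (t i)
  t<N i = s≤s (m≤m+n (t i) (t i))

  cdist-short : ∀ i b → cdist i (suc (t i + b)) (suc b) ≡ t i
  cdist-short i b = OddCycle.dist-antipodal (t i) (s≤s (m≤n+m b (t i))) (inj₁ (m+n∸n≡m (t i) b))

  cdist-long : ∀ i b → cdist i (suc (suc (t i + b))) (suc b) ≡ t i
  cdist-long i b = OddCycle.dist-antipodal (t i) (s≤s (≤-trans (m≤n+m b (t i)) (n≤1+n _)))
                     (inj₂ (trans (+-∸-assoc 1 (m≤n+m b (t i))) (cong suc (m+n∸n≡m (t i) b))))

  cdist-t-0 : ∀ i → cdist i (t i) 0 ≡ t i
  cdist-t-0 i = OddCycle.dist-antipodal (t i) z≤n (inj₁ refl)

  cdist-1-cut : ∀ i → cdist i 1 (suc (t i)) ≡ t i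
  cdist-1-cut i =
    trans (OddCycle.dist-sym (t i) (1+b<N i (t≥1 i)) (1+t<N i)) (OddCycle.dist-antipodal (t i) (s≤s z≤n) (inj₁ refl))

  module ForCover (C : List D) (VC : VertexCover C) where
    hit : Fin m → ℕ → ℕ
    hit i k = bit (memberAt C i k)

    hit-vertexAt : ∀ {i j a b} (al : a < OddCycle.N (t i)) (bl : b < OddCycle.N (t j)) →
      SREdge (vertexAt i al) (vertexAt j bl) → 1 ≤ hit i a ⊎ 1 ≤ hit j b
    hit-vertexAt {i} {j} al bl sr with VC _ _ sr
    ... | inj₁ mem = inj₁ (subst (λ z → 1 ≤ hit i z) (pos-vertexAt i al) (T⇒1≤bit (∈⇒memberAt mem)))
    ... | inj₂ mem = inj₂ (subst (λ z → 1 ≤ hit j z) (pos-vertexAt j bl) (T⇒1≤bit (∈⇒memberAt mem)))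

    inner-edge-hit : ∀ i {a b} (al : a < OddCycle.N (t i)) (bl : b < OddCycle.N (t i)) →
      (a ≢ 0 ⊎ toℕ i ≡ 0) → (b ≢ 0 ⊎ toℕ i ≡ 0) → NonCutPos i a → NonCutPos i b → a ≢ b →
      cdist i a b ≡ t i → CoversEdge (hit i) a b
    inner-edge-hit i {a} {b} al bl za zb na nb a≢b e = hit-vertexAt al bl
      (antipodal⇒SREdge (IsV-vertexAt i al za) (IsV-vertexAt i bl zb)
        (λ x → a≢b (trans (sym (pos-vertexAt i al)) (trans (cong (λ y → toℕ (proj₂ y)) x) (pos-vertexAt i bl))))
        (NonCut-vertexAt i al na) (NonCut-vertexAt i bl nb)
        (trans (cong₂ (cdist i) (pos-vertexAt i al) (trans exit-≡ (pos-vertexAt i bl))) e)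
        (trans (cong₂ (cdist i) (pos-vertexAt i bl) (trans exit-≡ (pos-vertexAt i al))) (trans (OddCycle.dist-sym (t i) bl al) e)))

    cross-edge-hit : ∀ {i j} → toℕ i < toℕ j → ∀ {a b} (al : a < OddCycle.N (t i)) (bl : b < OddCycle.N (t j)) →
      (a ≢ 0 ⊎ toℕ i ≡ 0) → b ≢ 0 → NonCutPos i a → NonCutPos j b →
      cdist i a (suc (t i)) ≡ t i → cdist j b 0 ≡ t j → 1 ≤ hit i a ⊎ 1 ≤ hit j b
    cross-edge-hit {i} {j} lt al bl za b≢0 na nb e₁ e₂ = hit-vertexAt al bl
      (antipodal⇒SREdge (IsV-vertexAt i al za) (IsV-vertexAt j bl (inj₁ b≢0)) (λ x → <-irrefl (cong (λ y → toℕ (proj₁ y)) x) lt)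
        (NonCut-vertexAt i al na) (NonCut-vertexAt j bl nb)
        (trans (cong₂ (cdist i) (pos-vertexAt i al) (exit-< lt)) e₁)
        (trans (cong₂ (cdist j) (pos-vertexAt j bl) (exit-> lt)) e₂))

    covers-short : ∀ i b → b < t i → b ≢ 0 ⊎ suc (toℕ i) ≡ m → CoversShort (t i) (hit i) b
    covers-short i b lt nonCut =
      inner-edge-hit i (1+b<N i lt) (1+t+b<N i lt) (inj₁ 1+n≢0) (inj₁ 1+n≢0)
        (inj₁ (λ e → <-irrefl (suc-injective e) lt)) (Sum.map₁ far-end nonCut) distinct
        (trans (OddCycle.dist-sym (t i) (1+b<N i lt) (1+t+b<N i lt)) (cdist-short i b))
      where
      far-end : b ≢ 0 → suc (t i + b) ≢ suc (t i)
      far-end b≢0 e = b≢0 (+-cancelˡ-≡ (t i) b 0 (trans (suc-injective e) (sym (+-identityʳ (t i)))))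
      distinct : suc b ≢ suc (t i + b)
      distinct e = <-irrefl (suc-injective e) (≤-trans (s≤s (m≤n+m b 0)) (+-monoˡ-≤ b (t≥1 i)))

    covers-long : ∀ i b → suc b < t i → CoversLong (t i) (hit i) b
    covers-long i b lt =
      inner-edge-hit i (2+t+b<N i lt) (1+b<N i b<t) (inj₁ 1+n≢0) (inj₁ 1+n≢0)
        (inj₁ (λ e → <-irrefl (sym (suc-injective e)) (s≤s (m≤m+n (t i) b))))
        (inj₁ (λ e → <-irrefl (suc-injective e) b<t))
        (λ e → <-irrefl (sym (suc-injective e)) (s≤s (m≤n+m b (t i))))
        (cdist-long i b)
      where
      b<t : b < t i
      b<t = <-trans (n<1+n b) lt

    covers-0-t : ∀ i → toℕ i ≡ 0 → CoversEdge (hit i) 0 (t i)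
    covers-0-t i z =
      inner-edge-hit i (0<N i) (t<N i) (inj₂ z) (inj₁ (λ e → <-irrefl (sym e) (t≥1 i)))
        (inj₁ (λ ())) (inj₁ (λ e → <-irrefl e (n<1+n (t i))))
        (λ e → <-irrefl e (t≥1 i)) (trans (OddCycle.dist-sym (t i) (0<N i) (t<N i)) (cdist-t-0 i))

    load : Fin m → ℕ
    load i = sumBelow (n i) (hit i)

    load≡cycleSum : ∀ i → load i ≡ cycleSum (t i) (hit i)
    load≡cycleSum i = trans (cong (λ N → sumBelow N (hit i)) (n≡2t+1 i)) (sumBelow-cycleSum (t i) (hit i))

    data LeftGap (i : Fin m) : Set where
      gap-0 : toℕ i ≡ 0 → hit i 0 ≡ 0 → LeftGap i
      gap-1 : hit i 1 ≡ 0 → LeftGap i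

    data RightGap (j : Fin m) : Set where
      gap-t   : hit j (t j) ≡ 0 → RightGap j
      gap-1+t : suc (toℕ j) ≡ m → hit j (suc (t j)) ≡ 0 → RightGap j

    -- Positions 0 and 1 of cycle i are antipodal to its exit t i + 1 towards later cycles.
    LeftGap⇒hit : ∀ {i j} → toℕ i < toℕ j → LeftGap i → ∀ {b} (bl : b < OddCycle.N (t j)) →
      b ≢ 0 → NonCutPos j b → cdist j b 0 ≡ t j → 1 ≤ hit j b
    LeftGap⇒hit {i} lt (gap-0 z g) bl b≢0 nb e =
      [ ⊥-elim ∘ <-irrefl (sym g) , id ]′ (cross-edge-hit lt (0<N i) bl (inj₂ z) b≢0 (inj₁ (λ ())) nb (cdist-0-cut i) e)
    LeftGap⇒hit {i} lt (gap-1 g) bl b≢0 nb e =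
      [ ⊥-elim ∘ <-irrefl (sym g) , id ]′ (cross-edge-hit lt (1+b<N i (t≥1 i)) bl (inj₁ 1+n≢0) b≢0
        (inj₁ (λ e′ → <-irrefl (suc-injective e′) (t≥1 i))) nb (cdist-1-cut i) e)

    ¬LeftGap×RightGap : ∀ {i j} → toℕ i < toℕ j → LeftGap i → RightGap j → ⊥
    ¬LeftGap×RightGap {j = j} lt L (gap-t g) = <-irrefl (sym g)
      (LeftGap⇒hit lt L (t<N j) (λ e → <-irrefl (sym e) (t≥1 j)) (inj₁ (λ e → <-irrefl e (n<1+n (t j)))) (cdist-t-0 j))
    ¬LeftGap×RightGap {j = j} lt L (gap-1+t l g) = <-irrefl (sym g)
      (LeftGap⇒hit lt L (1+t<N j) 1+n≢0 (inj₂ l) (cdist-cut-0 j))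

    first-cycle-bound : ∀ i → toℕ i ≡ 0 → t i ≤ load i × (load i ≤ t i → LeftGap i)
    first-cycle-bound i z rewrite load≡cycleSum i =
      proj₁ bound , λ le → [ gap-0 z , gap-1 ]′ (proj₂ bound le)
      where
      bound = first-cycle-cover (t i) (hit i) (t≥1 i) (λ b lt nz → covers-short i b lt (inj₁ nz)) (covers-long i) (covers-0-t i z)

    last-cycle-bound : ∀ i → suc (toℕ i) ≡ m → t i ≤ load i × (load i ≤ t i → RightGap i)
    last-cycle-bound i l rewrite load≡cycleSum i =
      proj₁ bound , λ le → [ gap-t , gap-1+t l ]′ (proj₂ bound le)
      where
      bound = last-cycle-cover (t i) (hit i) (t≥1 i) (λ b lt → covers-short i b lt (inj₂ l)) (covers-long i)

    middle-cycle-bound : ∀ i → t i ∸ 1 ≤ load i × (load i ≤ t i ∸ 1 → LeftGap i × RightGap i)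
    middle-cycle-bound i rewrite load≡cycleSum i =
      proj₁ bound , λ le → Product.map gap-1 gap-t (proj₂ bound le)
      where
      bound = middle-cycle-cover (t i) (hit i) (t≥2 i) (λ b lt nz → covers-short i b lt (inj₁ nz)) (covers-long i)

    cycle-bound : 2 ≤ m → ∀ i → term i ≤ load i ×
      (load i ≤ term i → (suc (toℕ i) ≢ m → LeftGap i) × (toℕ i ≢ 0 → RightGap i))
    cycle-bound m≥2 i with term-kind m≥2 i
    ... | inj₁ (z , e) rewrite e =
      proj₁ (first-cycle-bound i z) , λ le → (λ _ → proj₂ (first-cycle-bound i z) le) , λ nz → contradiction z nz
    ... | inj₂ (inj₁ (l , e)) rewrite e =
      proj₁ (last-cycle-bound i l) , λ le → (λ nl → contradiction l nl) , λ _ → proj₂ (last-cycle-bound i l) le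
    ... | inj₂ (inj₂ e) rewrite e =
      proj₁ (middle-cycle-bound i) ,
      λ le → (λ _ → proj₁ (proj₂ (middle-cycle-bound i) le)) , λ _ → proj₂ (proj₂ (middle-cycle-bound i) le)

    lower-bound : 2 ≤ m → ∑[ i < m ] term i + (m ∸ 1) ≤ length C
    lower-bound m≥2 = ≤-trans (∑+tight≤∑ m load term (λ i → proj₁ (cycle-bound m≥2 i)) no-two-tight) (occupancy≤length C)
      where
      no-two-tight : ∀ i j → toℕ i < toℕ j → load i ≤ term i → load j ≤ term j → ⊥
      no-two-tight i j i<j tight-i tight-j =
        ¬LeftGap×RightGap i<j (proj₁ (proj₂ (cycle-bound m≥2 i) tight-i) i-not-last)
                              (proj₂ (proj₂ (cycle-bound m≥2 j) tight-j) j-not-first)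
        where
        i-not-last : suc (toℕ i) ≢ m
        i-not-last e = <⇒≱ (toℕ<n j) (subst (_≤ toℕ j) e i<j)
        j-not-first : toℕ j ≢ 0
        j-not-first e = <-irrefl (sym e) (≤-trans z<s i<j)

5≤2t+1⇒2≤t : ∀ t → 5 ≤ suc (t + t) → 2 ≤ t
5≤2t+1⇒2≤t (suc (suc t)) _ = s≤s (s≤s z≤n)
5≤2t+1⇒2≤t 0 (s≤s ())
5≤2t+1⇒2≤t 1 (s≤s (s≤s (s≤s ())))

lemma3p7 : (m : ℕ) → 2 ≤ m → (n : Fin m → ℕ) →
    (∀ i → Odd (n i)) → (∀ i → 5 ≤ n i) →
    Chain.VertexCoverNumber m n (Chain.formula m n)
lemma3p7 m m≥2 n odd n≥5 =
  (coverList , coverList-isCover , length-coverList≡formula m≥2) ,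
  λ C isCover → subst (_≤ length C) (sym formula≡∑term) (ForCover.lower-bound C isCover m≥2)
  where
  t : Fin m → ℕ
  t i = proj₁ (odd i)
  n≡2t+1 : ∀ i → n i ≡ suc (t i + t i)
  n≡2t+1 i = trans (proj₂ (odd i)) (trans (+-comm _ 1) (cong (λ x → suc (t i + x)) (+-identityʳ (t i))))
  t≥2 : ∀ i → 2 ≤ t i
  t≥2 i = 5≤2t+1⇒2≤t (t i) (subst (5 ≤_) (n≡2t+1 i) (n≥5 i))
  t≥1 : ∀ i → 1 ≤ t i
  t≥1 i = ≤-trans (s≤s z≤n) (t≥2 i)
  open UpperBound m n t n≡2t+1 t≥1
  open LowerBound m n t n≡2t+1 t≥1 t≥2
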